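{- For every positive integer $N$ and all $w_1,w_2\in\mathcal{H}^1$, \[ \mathsf{F}_N(w_1;t)\,\mathsf{F}_N(w_2;t)=\mathsf{F}_N(w_1\,\overline{\ast}\,w_2;t). \]
   Context: $t$ is an indeterminate, $[n]=\{1,\dots,n\}$. For an index (tuple of positive integers) $\boldsymbol{k}=(k_1,\dots,k_r)$ and $A\subset[r]$, let $\overline{S}_{r,N}(A)$ be the set of $(n_1,\dots,n_r)\in[N-1]^r$ with $n_{i-1}\le n_i$ for $1<i\in[r]\setminus A$ and $n_{i-1}<n_i$ for $1<i\in A$, and \[ F_N(\boldsymbol{k};t)=\sum_{A\subset[r]}(-1)^{\#A}\sum_{(n_i)\in\overline{S}_{r,N}(A)}\prod_{i\in A}\frac{1}{(N-n_i+t)^{k_i}}\prod_{i\in[r]\setminus A}\frac{1}{n_i^{k_i}}\in\mathbb{Q}(t). \] $\mathcal{H}^1=\mathbb{Q}+y\mathbb{Q}\langle x,y\rangle$, $e_k=yx^{k-1}$; $\mathsf{F}_N\colon\mathcal{H}^1\to\mathbb{Q}(t)$ is $\mathbb{Q}$-linear with $\mathsf{F}_N(1)=1$ and $\mathsf{F}_N(e_{k_1}\cdots e_{k_r};t)=F_N((k_1,\dots,k_r);t)$. The star-harmonic product $\overline{\ast}$ on $\mathcal{H}^1$ is $\mathbb{Q}$-bilinear with $w\,\overline{\ast}\,1=1\,\overline{\ast}\,w=w$ and $w_1e_{k_1}\,\overline{\ast}\,w_2e_{k_2}=(w_1\,\overline{\ast}\,w_2e_{k_2})e_{k_1}+(w_1e_{k_1}\,\overline{\ast}\,w_2)e_{k_2}-(w_1\,\overline{\ast}\,w_2)e_{k_1+k_2}$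 for words $w_1,w_2\in\mathcal{H}^1$. -}

module Defs where

open import Data.Nat as ℕ using (ℕ; zero; suc; _∸_; _≤ᵇ_; _<ᵇ_)
open import Data.Integer as ℤ using (ℤ)
open import Data.Rational as ℚ using (ℚ; 0ℚ; 1ℚ)
open import Data.List using (List; []; _∷_; _++_; map; foldr; concatMap; reverse; replicate; length)
open import Data.List.Relation.Unary.All using (All)
open import Data.Bool using (Bool; true; false; if_then_else_; _∧_)
open import Data.Product using (_×_; _,_)
open import Relation.Binary.PropositionalEquality using (_≡_)

-- Polynomials ℚ[t] : coefficient lists, lowest degree first

Poly : Set
Poly = List ℚ

infixl 6 _+ₚ_
infixl 7 _*ₚ_

_+ₚ_ : Poly → Poly → Poly
[] +ₚ q = q
(a ∷ p) +ₚ [] = a ∷ p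
(a ∷ p) +ₚ (b ∷ q) = (a ℚ.+ b) ∷ (p +ₚ q)

scaleₚ : ℚ → Poly → Poly
scaleₚ c = map (c ℚ.*_)

_*ₚ_ : Poly → Poly → Poly
[] *ₚ q = []
(a ∷ p) *ₚ q = scaleₚ a q +ₚ (0ℚ ∷ (p *ₚ q))

-ₚ_ : Poly → Poly
-ₚ p = scaleₚ (ℚ.- 1ℚ) p

infix 4 _≈ₚ_
_≈ₚ_ : Poly → Poly → Set
p ≈ₚ q = All (_≡ 0ℚ) (p +ₚ (-ₚ q))

shiftP : ℕ → Poly
shiftP c = (ℤ.+ c ℚ./ 1) ∷ 1ℚ ∷ []

-- We only need the subring of ℚ(t) consisting
-- of fractions  p / ∏_j (c_j + t)  with c_j ∈ ℕ; the denominator is stored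
-- as the list of shifts c_j, so it is automatically a nonzero (monic)
-- polynomial.

record ℚ⟨t⟩ : Set where
  constructor _//_
  field
    num : Poly
    den : List ℕ
open ℚ⟨t⟩ public

denPoly : List ℕ → Poly
denPoly = foldr (λ c acc → shiftP c *ₚ acc) (1ℚ ∷ [])

infixl 6 _+ᵣ_
infixl 7 _*ᵣ_
infix 4 _≈ᵣ_

_+ᵣ_ : ℚ⟨t⟩ → ℚ⟨t⟩ → ℚ⟨t⟩
x +ᵣ y = (num x *ₚ denPoly (den y) +ₚ num y *ₚ denPoly (den x)) // (den x ++ den y)

_*ᵣ_ : ℚ⟨t⟩ → ℚ⟨t⟩ → ℚ⟨t⟩
x *ᵣ y = (num x *ₚ num y) // (den x ++ den y)

constᵣ : ℚ → ℚ⟨t⟩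
constᵣ c = (c ∷ []) // []

0ᵣ 1ᵣ : ℚ⟨t⟩
0ᵣ = constᵣ 0ℚ
1ᵣ = constᵣ 1ℚ

invShiftPow : ℕ → ℕ → ℚ⟨t⟩
invShiftPow c k = (1ℚ ∷ []) // replicate k c

_≈ᵣ_ : ℚ⟨t⟩ → ℚ⟨t⟩ → Set
x ≈ᵣ y = num x *ₚ denPoly (den y) ≈ₚ num y *ₚ denPoly (den x)

sumᵣ : List ℚ⟨t⟩ → ℚ⟨t⟩
sumᵣ = foldr _+ᵣ_ 0ᵣ

prodᵣ : List ℚ⟨t⟩ → ℚ⟨t⟩
prodᵣ = foldr _*ᵣ_ 1ᵣ

powℚ : ℚ → ℕ → ℚ
powℚ q zero = 1ℚ
powℚ q (suc k) = q ℚ.* powℚ q k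

invPow : ℕ → ℕ → ℚ
invPow zero k = 0ℚ   -- never used: tuple entries are ≥ 1
invPow (suc m) k = powℚ (ℤ.+ 1 ℚ./ suc m) k

-- [a, b] = a, a+1, ..., b  (counted by length)
range : ℕ → ℕ → List ℕ
range a zero = []
range a (suc l) = a ∷ range (suc a) l

tuples : ℕ → ℕ → List (List ℕ)
tuples N zero = [] ∷ []
tuples N (suc r) = concatMap (λ n → map (n ∷_) (tuples N r)) (range 1 (N ∸ 1))

-- all subsets A ⊂ [r] as characteristic Bool-lists
subsets : ℕ → List (List Bool)
subsets zero = [] ∷ []
subsets (suc r) = concatMap (λ b → map (b ∷_) (subsets r)) (true ∷ false ∷ [])

-- (n_i) ∈ S̄_{r,N}(A): n_{i-1} < n_i if i ∈ A, n_{i-1} ≤ n_i otherwise (i > 1)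
chainOK : ℕ → List Bool → List ℕ → Bool
chainOK prev (b ∷ bs) (n ∷ ns) = (if b then prev <ᵇ n else prev ≤ᵇ n) ∧ chainOK n bs ns
chainOK prev _ _ = true

inS : List Bool → List ℕ → Bool
inS (b ∷ bs) (n ∷ ns) = chainOK n bs ns
inS _ _ = true

signᵣ : List Bool → ℚ⟨t⟩
signᵣ [] = 1ᵣ
signᵣ (true ∷ bs) = constᵣ (ℚ.- 1ℚ) *ᵣ signᵣ bs
signᵣ (false ∷ bs) = signᵣ bs

termᵣ : ℕ → List ℕ → List Bool → List ℕ → ℚ⟨t⟩
termᵣ N (k ∷ ks) (true ∷ bs) (n ∷ ns) = invShiftPow (N ∸ n) k *ᵣ termᵣ N ks bs ns
termᵣ N (k ∷ ks) (false ∷ bs) (n ∷ ns) = constᵣ (invPow n k) *ᵣ termᵣ N ks bs ns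
termᵣ N _ _ _ = 1ᵣ

filterB : {A : Set} → (A → Bool) → List A → List A
filterB p [] = []
filterB p (x ∷ xs) = if p x then x ∷ filterB p xs else filterB p xs

F : ℕ → List ℕ → ℚ⟨t⟩
F N ks = sumᵣ (map (λ A → signᵣ A *ᵣ
           sumᵣ (map (termᵣ N ks A) (filterB (inS A) (tuples N (length ks)))))
         (subsets (length ks)))

-- ℋ¹ : formal ℚ-linear combinations of words e_{k_1}⋯e_{k_r}
-- (a word is its index list (k_1,...,k_r); the empty word is 1)

Word : Set
Word = List ℕ

H¹ : Set
H¹ = List (ℚ × Word)

PositiveWord : Word → Set
PositiveWord = All ℕ.NonZero

PositiveH¹ : H¹ → Set
PositiveH¹ = All (λ { (c , u) → PositiveWord u })

Fword : ℕ → Word → ℚ⟨t⟩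
Fword N [] = 1ᵣ
Fword N (k ∷ ks) = F N (k ∷ ks)

𝖥 : ℕ → H¹ → ℚ⟨t⟩
𝖥 N w = sumᵣ (map (λ { (c , u) → constᵣ c *ᵣ Fword N u }) w)

-- star-harmonic product on words, computed on reversed words
-- (head of the list = last letter)
prefixAll : ℕ → H¹ → H¹
prefixAll k = map (λ { (c , u) → (c , k ∷ u) })

negH : H¹ → H¹
negH = map (λ { (c , u) → (ℚ.- c , u) })

starRev : Word → Word → H¹
starRev [] v = (1ℚ , v) ∷ []
starRev (a ∷ u) [] = (1ℚ , a ∷ u) ∷ []
starRev (a ∷ u) (b ∷ v) =
  prefixAll a (starRev u (b ∷ v)) ++
  prefixAll b (starRev (a ∷ u) v) ++
  negH (prefixAll (a ℕ.+ b) (starRev u v))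

starWord : Word → Word → H¹
starWord u v = map (λ { (c , x) → (c , reverse x) }) (starRev (reverse u) (reverse v))

scaleH : ℚ → H¹ → H¹
scaleH d = map (λ { (c , u) → (d ℚ.* c , u) })

infixl 7 _⊛̄_
_⊛̄_ : H¹ → H¹ → H¹
w₁ ⊛̄ w₂ = concatMap (λ { (c₁ , u) → concatMap (λ { (c₂ , v) → scaleH (c₁ ℚ.* c₂) (starWord u v) }) w₂ }) w₁

{-# OPTIONS --safe #-}
module Submission where

open import Defs
open import Data.Nat using (ℕ; _≤_)

open import Algebra.Bundles using (AbelianGroup; CommutativeRing)
import Algebra.Consequences.Setoid as Consequences
open import Algebra.Core using (Op₁; Op₂)
import Algebra.Definitions as Definitions
open import Algebra.Morphism.Structures using (IsRingHomomorphism; module IsRingHomomorphism)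
open import Algebra.Solver.Ring.AlmostCommutativeRing using (fromCommutativeRing; _-Raw-AlmostCommutative⟶_)
import Algebra.Structures as Structures
open import Data.Bool using (Bool; true; false; if_then_else_; _∧_)
open import Data.Integer as ℤ using ()
open import Data.List using (List; []; _∷_; _++_; _∷ʳ_; map; foldr; concatMap; reverse; replicate; length)
import Data.List.Properties as List
open import Data.List.Relation.Unary.All using (All; []; _∷_)
open import Data.Maybe using (Maybe; just; nothing)
open import Data.Nat as ℕ using (zero; suc; _<_; _<ᵇ_; _≤ᵇ_; _∸_; z≤n; s≤s)
import Data.Nat.Properties as ℕ
open import Data.Product using (_,_)
open import Data.Rational as ℚ using (ℚ; 0ℚ; 1ℚ)
import Data.Rational.Properties as ℚ
open import Function using (_∘_)
open import Level using (Level; 0ℓ)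
open import Relation.Binary using (Rel; IsEquivalence; Setoid)
open import Relation.Binary.PropositionalEquality as ≡ using (_≡_)
open import Relation.Nullary using (yes; no)
open import Tactic.RingSolver using (solve-∀)
import Tactic.RingSolver.Core.AlmostCommutativeRing as Reflective

open import Algebra.Properties.Ring ℚ.+-*-ring using (-1*x≈-x)

-- Expanding the alternating sum over A, F_N(k) is the sum over chains 1 ≤ n₁ ≤ ⋯ ≤ n_r ≤ N − 1 of
-- products of letters, the i-th letter being X_{nᵢ}(kᵢ) = 1/nᵢ^kᵢ (a weak step n_{i-1} ≤ nᵢ) or
-- −Y_{nᵢ}(kᵢ) = −1/(N − nᵢ + t)^kᵢ (a strict step, i ∈ A). Let G_M(u) be the same sum over chains
-- with entries ≤ M; splitting off the chains that end at M gives
--   G_M(u e_a) = G_{M−1}(u e_a) + X_M(a) G_M(u) − Y_M(a) G_{M−1}(u).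
-- In a product G_M(u e_a) G_M(v e_b) the chains reaching M do so in the first word, in the second,
-- or in both at once; as X_M and Y_M turn exponents a + b into products, this is the recursion that
-- defines ⊛̄, so induction on M and on the words gives G_M(w₁) G_M(w₂) = G_M(w₁ ⊛̄ w₂).

range-suc : ∀ a l → range a (suc l) ≡ range a l ∷ʳ (a ℕ.+ l)
range-suc a zero    = ≡.cong (_∷ []) (≡.sym (ℕ.+-identityʳ a))
range-suc a (suc l) = ≡.cong (a ∷_) (≡.trans (range-suc (suc a) l) (≡.cong (range (suc a) l ∷ʳ_) (≡.sym (ℕ.+-suc a l))))

module ListSums {ℓ₁ ℓ₂ : Level} (R : CommutativeRing ℓ₁ ℓ₂) where

  open CommutativeRing R hiding (zero)
  open import Algebra.Properties.Ring ring using (-0#≈0#; -‿+-comm)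
  open import Algebra.Properties.CommutativeSemigroup +-commutativeSemigroup using (interchange)
  open import Relation.Binary.Reasoning.Setoid setoid

  ∑ : {A : Set} → List A → (A → Carrier) → Carrier
  ∑ xs f = foldr _+_ 0# (map f xs)

  when : Bool → Carrier → Carrier
  when b x = if b then x else 0#

  ∑-cong : {A : Set} (xs : List A) {f g : A → Carrier} → (∀ x → f x ≈ g x) → ∑ xs f ≈ ∑ xs g
  ∑-cong []       f≈g = refl
  ∑-cong (x ∷ xs) f≈g = +-cong (f≈g x) (∑-cong xs f≈g)

  ∑-++ : {A : Set} (xs ys : List A) (f : A → Carrier) → ∑ (xs ++ ys) f ≈ ∑ xs f + ∑ ys f
  ∑-++ []       ys f = sym (+-identityˡ _)
  ∑-++ (x ∷ xs) ys f = trans (+-congˡ (∑-++ xs ys f)) (sym (+-assoc _ _ _))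

  ∑-zero : {A : Set} (xs : List A) → ∑ xs (λ _ → 0#) ≈ 0#
  ∑-zero []       = refl
  ∑-zero (x ∷ xs) = trans (+-identityˡ _) (∑-zero xs)

  ∑-+ : {A : Set} (xs : List A) (f g : A → Carrier) → ∑ xs (λ x → f x + g x) ≈ ∑ xs f + ∑ xs g
  ∑-+ []       f g = sym (+-identityˡ 0#)
  ∑-+ (x ∷ xs) f g = trans (+-congˡ (∑-+ xs f g)) (interchange _ _ _ _)

  ∑-neg : {A : Set} (xs : List A) (f : A → Carrier) → ∑ xs (λ x → - f x) ≈ - ∑ xs f
  ∑-neg []       f = sym -0#≈0#
  ∑-neg (x ∷ xs) f = trans (+-congˡ (∑-neg xs f)) (-‿+-comm _ _)

  ∑-distribˡ : {A : Set} (a : Carrier) (xs : List A) (f : A → Carrier) → a * ∑ xs f ≈ ∑ xs (λ x → a * f x)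
  ∑-distribˡ a []       f = zeroʳ a
  ∑-distribˡ a (x ∷ xs) f = trans (distribˡ a _ _) (+-congˡ (∑-distribˡ a xs f))

  ∑-distribʳ : {A : Set} (a : Carrier) (xs : List A) (f : A → Carrier) → ∑ xs f * a ≈ ∑ xs (λ x → f x * a)
  ∑-distribʳ a []       f = zeroˡ a
  ∑-distribʳ a (x ∷ xs) f = trans (distribʳ a _ _) (+-congˡ (∑-distribʳ a xs f))

  ∑-linear : {A : Set} (xs : List A) (f g h : A → Carrier) (s t : Carrier) →
             ∑ xs (λ x → f x + (s * g x - t * h x)) ≈ ∑ xs f + (s * ∑ xs g - t * ∑ xs h)
  ∑-linear xs f g h s t = begin
    ∑ xs (λ x → f x + (s * g x - t * h x))
      ≈⟨ ∑-+ xs f _ ⟩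
    ∑ xs f + ∑ xs (λ x → s * g x - t * h x)
      ≈⟨ +-congˡ (∑-+ xs _ _) ⟩
    ∑ xs f + (∑ xs (λ x → s * g x) + ∑ xs (λ x → - (t * h x)))
      ≈⟨ +-congˡ (+-cong (∑-distribˡ s xs g) (trans (-‿cong (∑-distribˡ t xs h)) (sym (∑-neg xs _)))) ⟨
    ∑ xs f + (s * ∑ xs g - t * ∑ xs h) ∎

  ∑-map : {A B : Set} (g : B → A) (ys : List B) (f : A → Carrier) → ∑ (map g ys) f ≡ ∑ ys (f ∘ g)
  ∑-map g ys f = ≡.cong (foldr _+_ 0#) (≡.sym (List.map-∘ ys))

  ∑-concatMap : {A B : Set} (g : B → List A) (ys : List B) (f : A → Carrier) →
                ∑ (concatMap g ys) f ≈ ∑ ys (λ y → ∑ (g y) f)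
  ∑-concatMap g []       f = refl
  ∑-concatMap g (y ∷ ys) f = trans (∑-++ (g y) (concatMap g ys) f) (+-congˡ (∑-concatMap g ys f))

  ∑-filterB : {A : Set} (p : A → Bool) (xs : List A) (f : A → Carrier) →
              ∑ (filterB p xs) f ≈ ∑ xs (λ x → when (p x) (f x))
  ∑-filterB p []       f = refl
  ∑-filterB p (x ∷ xs) f with p x
  ... | true  = +-congˡ (∑-filterB p xs f)
  ... | false = trans (∑-filterB p xs f) (sym (+-identityˡ _))

  ∑-comm : {A B : Set} (xs : List A) (ys : List B) (f : A → B → Carrier) →
           ∑ xs (λ x → ∑ ys (f x)) ≈ ∑ ys (λ y → ∑ xs (λ x → f x y))
  ∑-comm []       ys f = sym (∑-zero ys)
  ∑-comm (x ∷ xs) ys f = trans (+-congˡ (∑-comm xs ys f)) (sym (∑-+ ys (f x) (λ y → ∑ xs (λ x → f x y))))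

  ∑-*-∑ : {A B : Set} (xs : List A) (ys : List B) (f : A → Carrier) (g : B → Carrier) →
          ∑ xs f * ∑ ys g ≈ ∑ xs (λ x → ∑ ys (λ y → f x * g y))
  ∑-*-∑ xs ys f g = trans (∑-distribʳ _ xs f) (∑-cong xs (λ x → ∑-distribˡ (f x) ys g))

  ∑-cong-range : (a l : ℕ) {f g : ℕ → Carrier} → (∀ {m} → a ≤ m → m < a ℕ.+ l → f m ≈ g m) →
                 ∑ (range a l) f ≈ ∑ (range a l) g
  ∑-cong-range a zero    f≈g = refl
  ∑-cong-range a (suc l) f≈g = +-cong (f≈g ℕ.≤-refl (ℕ.m<m+n a (s≤s z≤n)))
    (∑-cong-range (suc a) l λ a<m m<a+1+l →
      f≈g (ℕ.<⇒≤ a<m) (ℕ.<-≤-trans m<a+1+l (ℕ.≤-reflexive (≡.sym (ℕ.+-suc a l)))))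

  ∑-range-suc : (a l : ℕ) (f : ℕ → Carrier) → ∑ (range a (suc l)) f ≈ ∑ (range a l) f + f (a ℕ.+ l)
  ∑-range-suc a l f = begin
    ∑ (range a (suc l)) f                ≡⟨ ≡.cong (λ xs → ∑ xs f) (range-suc a l) ⟩
    ∑ (range a l ∷ʳ (a ℕ.+ l)) f         ≈⟨ ∑-++ (range a l) _ f ⟩
    ∑ (range a l) f + (f (a ℕ.+ l) + 0#) ≈⟨ +-congˡ (+-identityʳ _) ⟩
    ∑ (range a l) f + f (a ℕ.+ l)        ∎

-- Chain sums in a commutative ℚ-algebra

module ℚ-AlgebraSolver {ℓ₁ ℓ₂ : Level} (R : CommutativeRing ℓ₁ ℓ₂) {ι : ℚ → CommutativeRing.Carrier R}
  (ι-isRingHomomorphism : IsRingHomomorphism ℚ.+-*-rawRing (CommutativeRing.rawRing R) ι) where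

  open CommutativeRing R using (_≈_; refl)
  open IsRingHomomorphism ι-isRingHomomorphism

  ι-morphism : ℚ.+-*-rawRing -Raw-AlmostCommutative⟶ fromCommutativeRing R
  ι-morphism = record
    { ⟦_⟧ = ι ; +-homo = +-homo ; *-homo = *-homo ; -‿homo = -‿homo ; 0-homo = 0#-homo ; 1-homo = 1#-homo }

  ι-≟ : ∀ p q → Maybe (ι p ≈ ι q)
  ι-≟ p q with p ℚ.≟ q
  ... | yes ≡.refl = just refl
  ... | no _       = nothing

  open import Algebra.Solver.Ring ℚ.+-*-rawRing (fromCommutativeRing R) ι-morphism ι-≟ public

module LinearExtension {ℓ₁ ℓ₂ : Level} (R : CommutativeRing ℓ₁ ℓ₂) {ι : ℚ → CommutativeRing.Carrier R}
  (ι-isRingHomomorphism : IsRingHomomorphism ℚ.+-*-rawRing (CommutativeRing.rawRing R) ι) where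

  open CommutativeRing R hiding (zero)
  open import Algebra.Properties.Ring ring using (-‿distribˡ-*)
  open import Algebra.Properties.CommutativeSemigroup *-commutativeSemigroup using (interchange)
  open import Relation.Binary.Reasoning.Setoid setoid
  open IsRingHomomorphism ι-isRingHomomorphism using (*-homo; -‿homo)
  open ListSums R
  open ℚ-AlgebraSolver R ι-isRingHomomorphism using (solve; _:=_; _:+_; _:*_; :-_)

  *-distribˡ-linear : ∀ a x y z s t → a * (x + (s * y - t * z)) ≈ a * x + (s * (a * y) - t * (a * z))
  *-distribˡ-linear = solve 6 (λ a x y z s t →
    a :* (x :+ (s :* y :+ :- (t :* z))) := a :* x :+ (s :* (a :* y) :+ :- (t :* (a :* z)))) refl

  lin : (Word → Carrier) → H¹ → Carrier
  lin g h = ∑ h λ (c , u) → ι c * g u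

  lin-cong : ∀ {g g′ : Word → Carrier} h → (∀ u → g u ≈ g′ u) → lin g h ≈ lin g′ h
  lin-cong h g≈g′ = ∑-cong h λ (c , u) → *-congˡ (g≈g′ u)

  lin-linear : ∀ (f g k : Word → Carrier) s t h →
               lin (λ u → f u + (s * g u - t * k u)) h ≈ lin f h + (s * lin g h - t * lin k h)
  lin-linear f g k s t h =
    trans (∑-cong h λ (c , u) → *-distribˡ-linear (ι c) (f u) (g u) (k u) s t) (∑-linear h _ _ _ s t)

  lin-negH : ∀ g h → lin g (negH h) ≈ - lin g h
  lin-negH g h = begin
    lin g (negH h)
      ≡⟨ ∑-map _ h _ ⟩
    ∑ h (λ (c , u) → ι (ℚ.- c) * g u)
      ≈⟨ ∑-cong h (λ (c , u) → trans (*-congʳ (-‿homo c)) (sym (-‿distribˡ-* _ _))) ⟩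
    ∑ h (λ (c , u) → - (ι c * g u))
      ≈⟨ ∑-neg h _ ⟩
    - lin g h ∎

  lin-scaleH : ∀ g d h → lin g (scaleH d h) ≈ ι d * lin g h
  lin-scaleH g d h = begin
    lin g (scaleH d h)
      ≡⟨ ∑-map _ h _ ⟩
    ∑ h (λ (c , u) → ι (d ℚ.* c) * g u)
      ≈⟨ ∑-cong h (λ (c , u) → trans (*-congʳ (*-homo d c)) (*-assoc _ _ _)) ⟩
    ∑ h (λ (c , u) → ι d * (ι c * g u))
      ≈⟨ ∑-distribˡ (ι d) h _ ⟨
    ι d * lin g h ∎

  lin-prefixAll : ∀ g a h → lin g (prefixAll a h) ≡ lin (g ∘ (a ∷_)) h
  lin-prefixAll g a h = ∑-map _ h _

  lin-starRev-∷ : ∀ g a u b v → lin g (starRev (a ∷ u) (b ∷ v)) ≈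
    lin g (prefixAll a (starRev u (b ∷ v))) + (lin g (prefixAll b (starRev (a ∷ u) v)) - lin g (prefixAll (a ℕ.+ b) (starRev u v)))
  lin-starRev-∷ g a u b v =
    trans (∑-++ P₁ (P₂ ++ negH P₃) _) (+-congˡ (trans (∑-++ P₂ (negH P₃) _) (+-congˡ (lin-negH g P₃))))
    where
    P₁ P₂ P₃ : H¹
    P₁ = prefixAll a (starRev u (b ∷ v))
    P₂ = prefixAll b (starRev (a ∷ u) v)
    P₃ = prefixAll (a ℕ.+ b) (starRev u v)

  lin-⊛̄ : ∀ g → (∀ u v → lin g (starWord u v) ≈ g u * g v) →
          ∀ w₁ w₂ → lin g (w₁ ⊛̄ w₂) ≈ lin g w₁ * lin g w₂
  lin-⊛̄ g g-starWord w₁ w₂ = begin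
    lin g (w₁ ⊛̄ w₂)
      ≈⟨ ∑-concatMap _ w₁ _ ⟩
    ∑ w₁ (λ (c₁ , u) → lin g (concatMap (λ (c₂ , v) → scaleH (c₁ ℚ.* c₂) (starWord u v)) w₂))
      ≈⟨ ∑-cong w₁ (λ (c₁ , u) → ∑-concatMap _ w₂ _) ⟩
    ∑ w₁ (λ (c₁ , u) → ∑ w₂ (λ (c₂ , v) → lin g (scaleH (c₁ ℚ.* c₂) (starWord u v))))
      ≈⟨ ∑-cong w₁ (λ (c₁ , u) → ∑-cong w₂ (λ (c₂ , v) → term c₁ c₂ u v)) ⟩
    ∑ w₁ (λ (c₁ , u) → ∑ w₂ (λ (c₂ , v) → (ι c₁ * g u) * (ι c₂ * g v)))
      ≈⟨ ∑-*-∑ w₁ w₂ _ _ ⟨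
    lin g w₁ * lin g w₂ ∎
    where
    term : ∀ c₁ c₂ u v → lin g (scaleH (c₁ ℚ.* c₂) (starWord u v)) ≈ (ι c₁ * g u) * (ι c₂ * g v)
    term c₁ c₂ u v = begin
      lin g (scaleH (c₁ ℚ.* c₂) (starWord u v)) ≈⟨ lin-scaleH g (c₁ ℚ.* c₂) (starWord u v) ⟩
      ι (c₁ ℚ.* c₂) * lin g (starWord u v)      ≈⟨ *-cong (*-homo c₁ c₂) (g-starWord u v) ⟩
      (ι c₁ * ι c₂) * (g u * g v)               ≈⟨ interchange _ _ _ _ ⟩
      (ι c₁ * g u) * (ι c₂ * g v)               ∎

<ᵇ-true : ∀ {m n} → m < n → (m <ᵇ n) ≡ true
<ᵇ-true {zero}  (s≤s _)   = ≡.refl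
<ᵇ-true {suc m} (s≤s m<n) = <ᵇ-true m<n

≤ᵇ-true : ∀ {m n} → m ≤ n → (m ≤ᵇ n) ≡ true
≤ᵇ-true z≤n       = ≡.refl
≤ᵇ-true (s≤s m≤n) = <ᵇ-true (s≤s m≤n)

<ᵇ-false : ∀ {m n} → n ≤ m → (m <ᵇ n) ≡ false
<ᵇ-false z≤n       = ≡.refl
<ᵇ-false (s≤s n≤m) = <ᵇ-false n≤m

≤ᵇ-false : ∀ {m n} → n < m → (m ≤ᵇ n) ≡ false
≤ᵇ-false (s≤s n≤m) = <ᵇ-false n≤m

module ChainSums {ℓ₁ ℓ₂ : Level} (R : CommutativeRing ℓ₁ ℓ₂) {ι : ℚ → CommutativeRing.Carrier R}
  (ι-isRingHomomorphism : IsRingHomomorphism ℚ.+-*-rawRing (CommutativeRing.rawRing R) ι)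
  (X Y : ℕ → ℕ → CommutativeRing.Carrier R)
  (X-+-* : ∀ m a b → CommutativeRing._≈_ R (X m (a ℕ.+ b)) (CommutativeRing._*_ R (X m a) (X m b)))
  (Y-+-* : ∀ m a b → CommutativeRing._≈_ R (Y m (a ℕ.+ b)) (CommutativeRing._*_ R (Y m a) (Y m b))) where

  open CommutativeRing R hiding (zero)
  open import Algebra.Properties.CommutativeSemigroup *-commutativeSemigroup using (x∙yz≈y∙xz; interchange)
  open import Relation.Binary.Reasoning.Setoid setoid
  open IsRingHomomorphism ι-isRingHomomorphism using (1#-homo)
  open ListSums R
  open LinearExtension R ι-isRingHomomorphism
  open ℚ-AlgebraSolver R ι-isRingHomomorphism using (solve; _:=_; _:+_; _:*_; :-_; con)

  difference-cong : ∀ {x y p₁ q₁ p₀ q₀} → p₁ ≈ q₁ → p₀ ≈ q₀ → x * p₁ - y * p₀ ≈ x * q₁ - y * q₀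
  difference-cong p₁≈q₁ p₀≈q₀ = +-cong (*-congˡ p₁≈q₁) (-‿cong (*-congˡ p₀≈q₀))

  -- G M u is the chain sum of F with all entries ≤ M, for the word u read backwards
  -- (the head of u is the last letter), which is how starRev reads its words.
  G : ℕ → Word → Carrier
  G M       []      = 1#
  G zero    (a ∷ u) = 0#
  G (suc M) (a ∷ u) = G M (a ∷ u) + (X (suc M) a * G (suc M) u - Y (suc M) a * G M u)

  lin-G-prefixAll : ∀ M a h → lin (G (suc M)) (prefixAll a h) ≈
    lin (G M) (prefixAll a h) + (X (suc M) a * lin (G (suc M)) h - Y (suc M) a * lin (G M) h)
  lin-G-prefixAll M a h = begin
    lin (G (suc M)) (prefixAll a h)
      ≡⟨ lin-prefixAll (G (suc M)) a h ⟩
    lin (λ u → G M (a ∷ u) + (X (suc M) a * G (suc M) u - Y (suc M) a * G M u)) h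
      ≈⟨ lin-linear (G M ∘ (a ∷_)) (G (suc M)) (G M) _ _ h ⟩
    lin (G M ∘ (a ∷_)) h + (X (suc M) a * lin (G (suc M)) h - Y (suc M) a * lin (G M) h)
      ≈⟨ +-congʳ (reflexive (lin-prefixAll (G M) a h)) ⟨
    lin (G M) (prefixAll a h) + (X (suc M) a * lin (G (suc M)) h - Y (suc M) a * lin (G M) h) ∎

  lin-G₀-prefixAll : ∀ a h → lin (G 0) (prefixAll a h) ≈ 0#
  lin-G₀-prefixAll a h = trans (reflexive (lin-prefixAll (G 0) a h)) (trans (∑-cong h (λ _ → zeroʳ _)) (∑-zero h))

  -- The right-hand side of the recursion of starRev (a ∷ u) (b ∷ v) at level M + 1, with P₀ and P₁
  -- standing for the values at the levels M and M + 1.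
  starStep : ℕ → (Word → Word → Carrier) → (Word → Word → Carrier) → ℕ → Word → ℕ → Word → Carrier
  starStep M P₀ P₁ a u b v =
    P₀ (a ∷ u) (b ∷ v) +
    ((X (suc M) a * P₁ u (b ∷ v) - Y (suc M) a * P₀ u (b ∷ v)) +
     ((X (suc M) b * P₁ (a ∷ u) v - Y (suc M) b * P₀ (a ∷ u) v) -
      (X (suc M) (a ℕ.+ b) * P₁ u v - Y (suc M) (a ℕ.+ b) * P₀ u v)))

  lin-G-starRev-suc : ∀ M a u b v → lin (G (suc M)) (starRev (a ∷ u) (b ∷ v)) ≈
    starStep M (λ U V → lin (G M) (starRev U V)) (λ U V → lin (G (suc M)) (starRev U V)) a u b v
  lin-G-starRev-suc M a u b v = begin
    lin (G (suc M)) (starRev (a ∷ u) (b ∷ v))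
      ≈⟨ lin-starRev-∷ (G (suc M)) a u b v ⟩
    lin (G (suc M)) (prefixAll a S₁) + (lin (G (suc M)) (prefixAll b S₂) - lin (G (suc M)) (prefixAll (a ℕ.+ b) S₃))
      ≈⟨ +-cong (lin-G-prefixAll M a S₁) (+-cong (lin-G-prefixAll M b S₂) (-‿cong (lin-G-prefixAll M (a ℕ.+ b) S₃))) ⟩
    (lin (G M) (prefixAll a S₁) + W a S₁) +
      ((lin (G M) (prefixAll b S₂) + W b S₂) - (lin (G M) (prefixAll (a ℕ.+ b) S₃) + W (a ℕ.+ b) S₃))
      ≈⟨ regroup _ _ _ _ _ _ ⟩
    (lin (G M) (prefixAll a S₁) + (lin (G M) (prefixAll b S₂) - lin (G M) (prefixAll (a ℕ.+ b) S₃))) +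
      (W a S₁ + (W b S₂ - W (a ℕ.+ b) S₃))
      ≈⟨ +-congʳ (lin-starRev-∷ (G M) a u b v) ⟨
    lin (G M) (starRev (a ∷ u) (b ∷ v)) + (W a S₁ + (W b S₂ - W (a ℕ.+ b) S₃)) ∎
    where
    S₁ S₂ S₃ : H¹
    S₁ = starRev u (b ∷ v)
    S₂ = starRev (a ∷ u) v
    S₃ = starRev u v
    W : ℕ → H¹ → Carrier
    W k S = X (suc M) k * lin (G (suc M)) S - Y (suc M) k * lin (G M) S
    regroup : ∀ e₁ w₁ e₂ w₂ e₃ w₃ →
      (e₁ + w₁) + ((e₂ + w₂) - (e₃ + w₃)) ≈ (e₁ + (e₂ - e₃)) + (w₁ + (w₂ - w₃))
    regroup = solve 6 (λ e₁ w₁ e₂ w₂ e₃ w₃ →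
      (e₁ :+ w₁) :+ ((e₂ :+ w₂) :+ :- (e₃ :+ w₃)) := (e₁ :+ (e₂ :+ :- e₃)) :+ (w₁ :+ (w₂ :+ :- w₃))) refl

  -- In a product of two chain sums the chains reaching M + 1 do so in the first word, in the second,
  -- or in both at once; the last case is the letter a + b, by the exponent laws of X and Y.
  G-*-suc : ∀ M a u b v → G (suc M) (a ∷ u) * G (suc M) (b ∷ v) ≈
    starStep M (λ U V → G M U * G M V) (λ U V → G (suc M) U * G (suc M) V) a u b v
  G-*-suc M a u b v = begin
    G (suc M) (a ∷ u) * G (suc M) (b ∷ v)
      ≈⟨ expand (G M (a ∷ u)) (G M (b ∷ v)) (G (suc M) u) (G M u) (G (suc M) v) (G M v)
                (X (suc M) a) (X (suc M) b) (Y (suc M) a) (Y (suc M) b) ⟩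
    _ ≈⟨ +-congˡ (+-congˡ (+-congˡ (-‿cong
           (+-cong (*-congʳ (X-+-* (suc M) a b)) (-‿cong (*-congʳ (Y-+-* (suc M) a b))))))) ⟨
    starStep M (λ U V → G M U * G M V) (λ U V → G (suc M) U * G (suc M) V) a u b v ∎
    where
    expand : ∀ gU gV Gu gu Gv gv Xa Xb Ya Yb →
      (gU + (Xa * Gu - Ya * gu)) * (gV + (Xb * Gv - Yb * gv)) ≈
      gU * gV + ((Xa * (Gu * (gV + (Xb * Gv - Yb * gv))) - Ya * (gu * gV)) +
                 ((Xb * ((gU + (Xa * Gu - Ya * gu)) * Gv) - Yb * (gU * gv)) -
                  ((Xa * Xb) * (Gu * Gv) - (Ya * Yb) * (gu * gv))))
    expand = solve 10 (λ gU gV Gu gu Gv gv Xa Xb Ya Yb →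
      (gU :+ (Xa :* Gu :+ :- (Ya :* gu))) :* (gV :+ (Xb :* Gv :+ :- (Yb :* gv))) :=
      gU :* gV :+ ((Xa :* (Gu :* (gV :+ (Xb :* Gv :+ :- (Yb :* gv)))) :+ :- (Ya :* (gu :* gV))) :+
                   ((Xb :* ((gU :+ (Xa :* Gu :+ :- (Ya :* gu))) :* Gv) :+ :- (Yb :* (gU :* gv))) :+
                    :- ((Xa :* Xb) :* (Gu :* Gv) :+ :- ((Ya :* Yb) :* (gu :* gv)))))) refl

  G-starRev : ∀ M U V → lin (G M) (starRev U V) ≈ G M U * G M V
  G-starRev M       []      V       = trans (+-identityʳ _) (*-congʳ 1#-homo)
  G-starRev M       (a ∷ u) []      = trans (+-identityʳ _) (trans (*-congʳ 1#-homo) (*-comm _ _))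
  G-starRev zero    (a ∷ u) (b ∷ v) = begin
    lin (G 0) (starRev (a ∷ u) (b ∷ v))
      ≈⟨ lin-starRev-∷ (G 0) a u b v ⟩
    _ ≈⟨ +-cong (lin-G₀-prefixAll a (starRev u (b ∷ v)))
           (+-cong (lin-G₀-prefixAll b (starRev (a ∷ u) v)) (-‿cong (lin-G₀-prefixAll (a ℕ.+ b) (starRev u v)))) ⟩
    0# + (0# - 0#) ≈⟨ trans (+-identityˡ _) (-‿inverseʳ 0#) ⟩
    0#             ≈⟨ zeroˡ 0# ⟨
    0# * 0#        ∎
  G-starRev (suc M) (a ∷ u) (b ∷ v) = begin
    lin (G (suc M)) (starRev (a ∷ u) (b ∷ v))
      ≈⟨ lin-G-starRev-suc M a u b v ⟩
    starStep M (λ U V → lin (G M) (starRev U V)) (λ U V → lin (G (suc M)) (starRev U V)) a u b v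
      ≈⟨ +-cong (G-starRev M (a ∷ u) (b ∷ v))
           (+-cong (difference-cong (G-starRev (suc M) u (b ∷ v)) (G-starRev M u (b ∷ v)))
             (+-cong (difference-cong (G-starRev (suc M) (a ∷ u) v) (G-starRev M (a ∷ u) v))
               (-‿cong (difference-cong (G-starRev (suc M) u v) (G-starRev M u v))))) ⟩
    starStep M (λ U V → G M U * G M V) (λ U V → G (suc M) U * G (suc M) V) a u b v
      ≈⟨ G-*-suc M a u b v ⟨
    G (suc M) (a ∷ u) * G (suc M) (b ∷ v) ∎

  G-starWord : ∀ M u v → lin (G M ∘ reverse) (starWord u v) ≈ G M (reverse u) * G M (reverse v)
  G-starWord M u v = begin
    lin (G M ∘ reverse) (starWord u v)
      ≡⟨ ∑-map _ (starRev (reverse u) (reverse v)) _ ⟩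
    lin (G M ∘ reverse ∘ reverse) (starRev (reverse u) (reverse v))
      ≈⟨ lin-cong (starRev (reverse u) (reverse v)) (λ x → reflexive (≡.cong (G M) (List.reverse-involutive x))) ⟩
    lin (G M) (starRev (reverse u) (reverse v))
      ≈⟨ G-starRev M (reverse u) (reverse v) ⟩
    G M (reverse u) * G M (reverse v) ∎

  -- The Boolean records whether the position of the entry lies in A.
  factor : Bool → ℕ → ℕ → Carrier
  factor true  k m = ι (ℚ.- 1ℚ) * Y m k
  factor false k m = X m k

  after : ℕ → Bool → ℕ → Bool
  after p b m = if b then p <ᵇ m else p ≤ᵇ m

  bools : List Bool
  bools = true ∷ false ∷ []

  extend : (Bool → ℕ → Bool) → ℕ → ℕ → (ℕ → Carrier) → Carrier
  extend h M k f = ∑ bools λ b → ∑ (range 1 M) λ m → when (h b m) (factor b k m) * f m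

  -- C M p ks is the chain sum for ks read forwards, with entries in [1, M] and the first step
  -- taken from p; this is the order in which tuples and subsets enumerate.
  C : ℕ → ℕ → Word → Carrier
  C M p []       = 1#
  C M p (k ∷ ks) = extend (after p) M k (λ m → C M m ks)

  after-< : ∀ {p m} → p < m → ∀ b → after p b m ≡ true
  after-< p<m true  = <ᵇ-true p<m
  after-< p<m false = ≤ᵇ-true (ℕ.<⇒≤ p<m)

  after-> : ∀ {p m} → m < p → ∀ b → after p b m ≡ false
  after-> m<p true  = <ᵇ-false (ℕ.<⇒≤ m<p)
  after-> m<p false = ≤ᵇ-false m<p

  when-cong : ∀ {x y} r → x ≡ y → when x r ≈ when y r
  when-cong r x≡y = reflexive (≡.cong (λ x → when x r) x≡y)

  extend-cong : ∀ (h h′ : Bool → ℕ → Bool) M k {f g : ℕ → Carrier} →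
    (∀ b {m} → 1 ≤ m → m ≤ M → h b m ≡ h′ b m) → (∀ {m} → 1 ≤ m → m ≤ M → f m ≈ g m) →
    extend h M k f ≈ extend h′ M k g
  extend-cong h h′ M k h≡h′ f≈g = ∑-cong bools λ b → ∑-cong-range 1 M λ {m} 1≤m m<1+M →
    *-cong (when-cong (factor b k m) (h≡h′ b 1≤m (ℕ.≤-pred m<1+M))) (f≈g 1≤m (ℕ.≤-pred m<1+M))

  extend-linear : ∀ h M k (f g u : ℕ → Carrier) s t →
    extend h M k (λ m → f m + (s * g m - t * u m)) ≈ extend h M k f + (s * extend h M k g - t * extend h M k u)
  extend-linear h M k f g u s t = trans (∑-cong bools inner) (∑-linear bools (Σ f) (Σ g) (Σ u) s t)
    where
    w : Bool → ℕ → Carrier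
    w b m = when (h b m) (factor b k m)
    Σ : (ℕ → Carrier) → Bool → Carrier
    Σ φ b = ∑ (range 1 M) λ m → w b m * φ m
    inner : ∀ b → Σ (λ m → f m + (s * g m - t * u m)) b ≈ Σ f b + (s * Σ g b - t * Σ u b)
    inner b = trans (∑-cong (range 1 M) λ m → *-distribˡ-linear (w b m) (f m) (g m) (u m) s t)
                    (∑-linear (range 1 M) (λ m → w b m * f m) (λ m → w b m * g m) (λ m → w b m * u m) s t)

  extend-zero : ∀ h k f → extend h 0 k f ≈ 0#
  extend-zero h k f = ∑-zero bools

  extend-never : ∀ M k f → extend (λ _ _ → false) M k f ≈ 0#
  extend-never M k f = trans
    (∑-cong bools λ b → trans (∑-cong (range 1 M) λ m → zeroˡ (f m)) (∑-zero (range 1 M)))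
    (∑-zero bools)

  extend-suc : ∀ h M k f → extend h (suc M) k f ≈
    extend h M k f + ∑ bools (λ b → when (h b (suc M)) (factor b k (suc M)) * f (suc M))
  extend-suc h M k f = trans (∑-cong bools λ b → ∑-range-suc 1 M (term b))
                             (∑-+ bools (λ b → ∑ (range 1 M) (term b)) (λ b → term b (suc M)))
    where
    term : Bool → ℕ → Carrier
    term b m = when (h b m) (factor b k m) * f m

  extend-top : ∀ M k f → extend (after (suc M)) (suc M) k f ≈ X (suc M) k * f (suc M)
  extend-top M k f = begin
    extend (after (suc M)) (suc M) k f
      ≈⟨ extend-suc (after (suc M)) M k f ⟩
    extend (after (suc M)) M k f + ∑ bools (λ b → when (after (suc M) b (suc M)) (factor b k (suc M)) * f (suc M))
      ≈⟨ +-cong below (+-cong (*-congʳ (when-cong _ (<ᵇ-false (ℕ.≤-refl {suc M}))))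
                              (+-congʳ (*-congʳ (when-cong _ (≤ᵇ-true (ℕ.≤-refl {suc M})))))) ⟩
    0# + (0# * f (suc M) + (X (suc M) k * f (suc M) + 0#))
      ≈⟨ trans (+-identityˡ _) (trans (+-congʳ (zeroˡ _)) (trans (+-identityˡ _) (+-identityʳ _))) ⟩
    X (suc M) k * f (suc M) ∎
    where
    below : extend (after (suc M)) M k f ≈ 0#
    below = trans (extend-cong (after (suc M)) (λ _ _ → false) M k (λ b _ m≤M → after-> (s≤s m≤M) b) (λ _ _ → refl))
                  (extend-never M k f)

  extend-below : ∀ {p M} k f → p < suc M → extend (after p) (suc M) k f ≈
    extend (after p) M k f + (X (suc M) k * f (suc M) - Y (suc M) k * f (suc M))
  extend-below {p} {M} k f p<1+M = begin
    extend (after p) (suc M) k f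
      ≈⟨ extend-suc (after p) M k f ⟩
    extend (after p) M k f + ∑ bools (λ b → when (after p b (suc M)) (factor b k (suc M)) * f (suc M))
      ≈⟨ +-congˡ (+-cong (*-congʳ (when-cong _ (after-< p<1+M true))) (+-congʳ (*-congʳ (when-cong _ (after-< p<1+M false))))) ⟩
    extend (after p) M k f + ((ι (ℚ.- 1ℚ) * Y (suc M) k) * f (suc M) + (X (suc M) k * f (suc M) + 0#))
      ≈⟨ +-congˡ (trans (+-congˡ (+-identityʳ _)) (signs (X (suc M) k) (Y (suc M) k) (f (suc M)))) ⟩
    extend (after p) M k f + (X (suc M) k * f (suc M) - Y (suc M) k * f (suc M)) ∎
    where
    signs : ∀ x y z → (ι (ℚ.- 1ℚ) * y) * z + x * z ≈ x * z - y * z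
    signs = solve 3 (λ x y z → (con (ℚ.- 1ℚ) :* y) :* z :+ x :* z := x :* z :+ :- (y :* z)) refl

  C-zero-∷ʳ : ∀ p ks a → C 0 p (ks ∷ʳ a) ≈ 0#
  C-zero-∷ʳ p []       a = extend-zero (after p) a (λ _ → 1#)
  C-zero-∷ʳ p (k ∷ ks) a = extend-zero (after p) k (λ m → C 0 m (ks ∷ʳ a))

  C-top-∷ʳ : ∀ M ks a → C (suc M) (suc M) (ks ∷ʳ a) ≈ X (suc M) a * C (suc M) (suc M) ks
  C-top-∷ʳ M []       a = extend-top M a _
  C-top-∷ʳ M (k ∷ ks) a = begin
    C (suc M) (suc M) ((k ∷ ks) ∷ʳ a)              ≈⟨ extend-top M k _ ⟩
    X (suc M) k * C (suc M) (suc M) (ks ∷ʳ a)        ≈⟨ *-congˡ (C-top-∷ʳ M ks a) ⟩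
    X (suc M) k * (X (suc M) a * C (suc M) (suc M) ks) ≈⟨ x∙yz≈y∙xz _ _ _ ⟩
    X (suc M) a * (X (suc M) k * C (suc M) (suc M) ks) ≈⟨ *-congˡ (extend-top M k _) ⟨
    X (suc M) a * C (suc M) (suc M) (k ∷ ks)         ∎

  C-∷ʳ : ∀ M p ks a → p < suc M →
    C (suc M) p (ks ∷ʳ a) ≈ C M p (ks ∷ʳ a) + (X (suc M) a * C (suc M) p ks - Y (suc M) a * C M p ks)
  C-∷ʳ M p []       a p<1+M = extend-below a _ p<1+M
  C-∷ʳ M p (k ∷ ks) a p<1+M = begin
    C (suc M) p ((k ∷ ks) ∷ʳ a)
      ≈⟨ extend-below k _ p<1+M ⟩
    E (λ m → C (suc M) m (ks ∷ʳ a)) + (X′ k * C (suc M) (suc M) (ks ∷ʳ a) - Y′ k * C (suc M) (suc M) (ks ∷ʳ a))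
      ≈⟨ +-cong (extend-cong (after p) (after p) M k (λ _ _ _ → ≡.refl) (λ _ m≤M → C-∷ʳ M _ ks a (s≤s m≤M)))
                (difference-cong (C-top-∷ʳ M ks a) (C-top-∷ʳ M ks a)) ⟩
    E (λ m → C M m (ks ∷ʳ a) + (X′ a * C (suc M) m ks - Y′ a * C M m ks)) + (X′ k * (X′ a * T) - Y′ k * (X′ a * T))
      ≈⟨ +-congʳ (extend-linear (after p) M k _ _ _ (X′ a) (Y′ a)) ⟩
    (C M p ((k ∷ ks) ∷ʳ a) + (X′ a * E (λ m → C (suc M) m ks) - Y′ a * C M p (k ∷ ks))) +
      (X′ k * (X′ a * T) - Y′ k * (X′ a * T))
      ≈⟨ regroup _ _ _ T _ _ _ _ ⟩
    C M p ((k ∷ ks) ∷ʳ a) + (X′ a * (E (λ m → C (suc M) m ks) + (X′ k * T - Y′ k * T)) - Y′ a * C M p (k ∷ ks))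
      ≈⟨ +-congˡ (+-congʳ (*-congˡ (extend-below k _ p<1+M))) ⟨
    C M p ((k ∷ ks) ∷ʳ a) + (X′ a * C (suc M) p (k ∷ ks) - Y′ a * C M p (k ∷ ks)) ∎
    where
    E : (ℕ → Carrier) → Carrier
    E = extend (after p) M k
    X′ Y′ : ℕ → Carrier
    X′ = X (suc M)
    Y′ = Y (suc M)
    T : Carrier
    T = C (suc M) (suc M) ks
    regroup : ∀ e b c t xa ya xk yk →
      (e + (xa * b - ya * c)) + (xk * (xa * t) - yk * (xa * t)) ≈ e + (xa * (b + (xk * t - yk * t)) - ya * c)
    regroup = solve 8 (λ e b c t xa ya xk yk →
      (e :+ (xa :* b :+ :- (ya :* c))) :+ (xk :* (xa :* t) :+ :- (yk :* (xa :* t))) :=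
      e :+ (xa :* (b :+ (xk :* t :+ :- (yk :* t))) :+ :- (ya :* c))) refl

  C-G : ∀ M u → C M 0 (reverse u) ≈ G M u
  C-G M       []      = refl
  C-G zero    (a ∷ u) = trans (reflexive (≡.cong (C 0 0) (List.unfold-reverse a u))) (C-zero-∷ʳ 0 (reverse u) a)
  C-G (suc M) (a ∷ u) = begin
    C (suc M) 0 (reverse (a ∷ u))
      ≡⟨ ≡.cong (C (suc M) 0) (List.unfold-reverse a u) ⟩
    C (suc M) 0 (reverse u ∷ʳ a)
      ≈⟨ C-∷ʳ M 0 (reverse u) a (s≤s z≤n) ⟩
    C M 0 (reverse u ∷ʳ a) + (X (suc M) a * C (suc M) 0 (reverse u) - Y (suc M) a * C M 0 (reverse u))
      ≈⟨ +-cong (trans (reflexive (≡.cong (C M 0) (≡.sym (List.unfold-reverse a u)))) (C-G M (a ∷ u)))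
                (difference-cong (C-G (suc M) u) (C-G M u)) ⟩
    G (suc M) (a ∷ u) ∎

  -- sign, weight and Fsum transcribe signᵣ, termᵣ N and F N into R; for R = ℚ⟨t⟩ with
  -- X m k = constᵣ (invPow m k) and Y m k = invShiftPow (N ∸ m) k they are the same functions.
  module _ (N : ℕ) where

    sign : List Bool → Carrier
    sign []           = 1#
    sign (true  ∷ bs) = ι (ℚ.- 1ℚ) * sign bs
    sign (false ∷ bs) = sign bs

    weight : Word → List Bool → List ℕ → Carrier
    weight (k ∷ ks) (true  ∷ bs) (n ∷ ns) = Y n k * weight ks bs ns
    weight (k ∷ ks) (false ∷ bs) (n ∷ ns) = X n k * weight ks bs ns
    weight _        _            _        = 1#

    Fsum : Word → Carrier
    Fsum ks = ∑ (subsets (length ks)) λ A → sign A * ∑ (filterB (inS A) (tuples N (length ks))) (weight ks A)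

    chainFrom : (Bool → ℕ → Bool) → List Bool → List ℕ → Bool
    chainFrom h (b ∷ bs) (n ∷ ns) = h b n ∧ chainOK n bs ns
    chainFrom h _        _        = true

    inS≡chainFrom : ∀ A ns → inS A ns ≡ chainFrom (λ _ _ → true) A ns
    inS≡chainFrom []      ns       = ≡.refl
    inS≡chainFrom (b ∷ A) []       = ≡.refl
    inS≡chainFrom (b ∷ A) (n ∷ ns) = ≡.refl

    chainOK≡chainFrom : ∀ p A ns → chainOK p A ns ≡ chainFrom (after p) A ns
    chainOK≡chainFrom p []      ns       = ≡.refl
    chainOK≡chainFrom p (b ∷ A) []       = ≡.refl
    chainOK≡chainFrom p (b ∷ A) (n ∷ ns) = ≡.refl

    chainSum : (Bool → ℕ → Bool) → Word → Carrier
    chainSum h ks =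
      ∑ (subsets (length ks)) λ A → sign A * ∑ (tuples N (length ks)) λ ns → when (chainFrom h A ns) (weight ks A ns)

    Fsum≈chainSum : ∀ ks → Fsum ks ≈ chainSum (λ _ _ → true) ks
    Fsum≈chainSum ks = ∑-cong (subsets (length ks)) λ A → *-congˡ
      (trans (∑-filterB (inS A) (tuples N (length ks)) (weight ks A))
             (∑-cong (tuples N (length ks)) λ ns → when-cong (weight ks A ns) (inS≡chainFrom A ns)))

    chainSum-[] : ∀ h → chainSum h [] ≈ 1#
    chainSum-[] h = trans (+-identityʳ _) (trans (*-identityˡ _) (+-identityʳ _))

    sign-weight-∷ : ∀ b A k ks m ns x y →
      sign (b ∷ A) * when (x ∧ y) (weight (k ∷ ks) (b ∷ A) (m ∷ ns)) ≈
      when x (factor b k m) * (sign A * when y (weight ks A ns))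
    sign-weight-∷ b     A k ks m ns false y     = trans (zeroʳ _) (sym (zeroˡ _))
    sign-weight-∷ b     A k ks m ns true  false = trans (zeroʳ _) (sym (trans (*-congˡ (zeroʳ _)) (zeroʳ _)))
    sign-weight-∷ true  A k ks m ns true  true  = interchange _ _ _ _
    sign-weight-∷ false A k ks m ns true  true  = x∙yz≈y∙xz _ _ _

    chainSum-∷ : ∀ h k ks → chainSum h (k ∷ ks) ≈ extend h (N ∸ 1) k (λ m → chainSum (after m) ks)
    chainSum-∷ h k ks = begin
      chainSum h (k ∷ ks)
        ≈⟨ ∑-concatMap (λ b → map (b ∷_) (subsets r)) bools _ ⟩
      ∑ bools (λ b → ∑ (map (b ∷_) (subsets r)) term)
        ≈⟨ ∑-cong bools (λ b → reflexive (∑-map (b ∷_) (subsets r) term)) ⟩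
      ∑ bools (λ b → ∑ (subsets r) λ A → term (b ∷ A))
        ≈⟨ ∑-cong bools (λ b → ∑-cong (subsets r) (peel b)) ⟩
      ∑ bools (λ b → ∑ (subsets r) λ A → ∑ rng λ m → when (h b m) (factor b k m) * T m A)
        ≈⟨ ∑-cong bools (λ b → ∑-comm (subsets r) rng (λ A m → when (h b m) (factor b k m) * T m A)) ⟩
      ∑ bools (λ b → ∑ rng λ m → ∑ (subsets r) λ A → when (h b m) (factor b k m) * T m A)
        ≈⟨ ∑-cong bools (λ b → ∑-cong rng (λ m → ∑-distribˡ (when (h b m) (factor b k m)) (subsets r) (T m))) ⟨
      extend h (N ∸ 1) k (λ m → chainSum (after m) ks) ∎
      where
      r : ℕ
      r = length ks
      rng : List ℕ
      rng = range 1 (N ∸ 1)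
      term : List Bool → Carrier
      term A = sign A * ∑ (tuples N (suc r)) λ ns → when (chainFrom h A ns) (weight (k ∷ ks) A ns)
      T : ℕ → List Bool → Carrier
      T m A = sign A * ∑ (tuples N r) λ ns → when (chainFrom (after m) A ns) (weight ks A ns)
      peel : ∀ b A → term (b ∷ A) ≈ ∑ rng λ m → when (h b m) (factor b k m) * T m A
      peel b A = begin
        term (b ∷ A)
          ≈⟨ *-congˡ (∑-concatMap (λ n → map (n ∷_) (tuples N r)) rng φ) ⟩
        sign (b ∷ A) * ∑ rng (λ m → ∑ (map (m ∷_) (tuples N r)) φ)
          ≈⟨ ∑-distribˡ (sign (b ∷ A)) rng (λ m → ∑ (map (m ∷_) (tuples N r)) φ) ⟩
        ∑ rng (λ m → sign (b ∷ A) * ∑ (map (m ∷_) (tuples N r)) φ)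
          ≈⟨ ∑-cong rng entry ⟩
        ∑ rng (λ m → when (h b m) (factor b k m) * T m A) ∎
        where
        φ : List ℕ → Carrier
        φ ns = when (chainFrom h (b ∷ A) ns) (weight (k ∷ ks) (b ∷ A) ns)
        ψ : ℕ → List ℕ → Carrier
        ψ m ns = when (chainFrom (after m) A ns) (weight ks A ns)
        entry : ∀ m → sign (b ∷ A) * ∑ (map (m ∷_) (tuples N r)) φ ≈ when (h b m) (factor b k m) * T m A
        entry m = begin
          sign (b ∷ A) * ∑ (map (m ∷_) (tuples N r)) φ
            ≡⟨ ≡.cong (sign (b ∷ A) *_) (∑-map (m ∷_) (tuples N r) φ) ⟩
          sign (b ∷ A) * ∑ (tuples N r) (φ ∘ (m ∷_))
            ≈⟨ ∑-distribˡ (sign (b ∷ A)) (tuples N r) (φ ∘ (m ∷_)) ⟩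
          ∑ (tuples N r) (λ ns → sign (b ∷ A) * φ (m ∷ ns))
            ≈⟨ ∑-cong (tuples N r) (λ ns → trans (*-congˡ (when-cong _ (≡.cong (h b m ∧_) (chainOK≡chainFrom m A ns))))
                                                 (sign-weight-∷ b A k ks m ns (h b m) _)) ⟩
          ∑ (tuples N r) (λ ns → when (h b m) (factor b k m) * (sign A * ψ m ns))
            ≈⟨ ∑-distribˡ (when (h b m) (factor b k m)) (tuples N r) (λ ns → sign A * ψ m ns) ⟨
          when (h b m) (factor b k m) * ∑ (tuples N r) (λ ns → sign A * ψ m ns)
            ≈⟨ *-congˡ (∑-distribˡ (sign A) (tuples N r) (ψ m)) ⟨
          when (h b m) (factor b k m) * T m A ∎

    chainSum-after≈C : ∀ p ks → chainSum (after p) ks ≈ C (N ∸ 1) p ks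
    chainSum-after≈C p []       = chainSum-[] (after p)
    chainSum-after≈C p (k ∷ ks) = trans (chainSum-∷ (after p) k ks)
      (extend-cong (after p) (after p) (N ∸ 1) k (λ _ _ _ → ≡.refl) (λ {m} _ _ → chainSum-after≈C m ks))

    chainSum-true≈C : ∀ ks → chainSum (λ _ _ → true) ks ≈ C (N ∸ 1) 0 ks
    chainSum-true≈C []       = chainSum-[] (λ _ _ → true)
    chainSum-true≈C (k ∷ ks) = trans (chainSum-∷ (λ _ _ → true) k ks)
      (extend-cong (λ _ _ → true) (after 0) (N ∸ 1) k (λ b 1≤m _ → ≡.sym (after-< 1≤m b))
                   (λ {m} _ _ → chainSum-after≈C m ks))

    Fsum≈G : ∀ ks → Fsum ks ≈ G (N ∸ 1) (reverse ks)
    Fsum≈G ks = begin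
      Fsum ks                             ≈⟨ Fsum≈chainSum ks ⟩
      chainSum (λ _ _ → true) ks          ≈⟨ chainSum-true≈C ks ⟩
      C (N ∸ 1) 0 ks                      ≡⟨ ≡.cong (C (N ∸ 1) 0) (List.reverse-involutive ks) ⟨
      C (N ∸ 1) 0 (reverse (reverse ks))  ≈⟨ C-G (N ∸ 1) (reverse ks) ⟩
      G (N ∸ 1) (reverse ks)              ∎

-- The polynomial ring ℚ[t]

module LeftLaws {A : Set} {_≈_ : Rel A 0ℓ} (≈-isEquivalence : IsEquivalence _≈_) where
  open Definitions _≈_
  open Structures _≈_

  ≈-setoid : Setoid 0ℓ 0ℓ
  ≈-setoid = record { isEquivalence = ≈-isEquivalence }

  open Consequences ≈-setoid

  isAbelianGroupˡ : ∀ {_+_ : Op₂ A} {0# : A} { -_ : Op₁ A} →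
    Congruent₂ _+_ → Congruent₁ -_ → Associative _+_ → Commutative _+_ →
    LeftIdentity 0# _+_ → LeftInverse 0# -_ _+_ → IsAbelianGroup _+_ 0# -_
  isAbelianGroupˡ +-cong -‿cong +-assoc +-comm +-identityˡ -‿inverseˡ = record
    { isGroup = record
      { isMonoid = record
        { isSemigroup = record { isMagma = record { isEquivalence = ≈-isEquivalence ; ∙-cong = +-cong } ; assoc = +-assoc }
        ; identity    = comm∧idˡ⇒id +-comm +-identityˡ
        }
      ; inverse = comm∧invˡ⇒inv +-comm -‿inverseˡ
      ; ⁻¹-cong = -‿cong
      }
    ; comm = +-comm
    }

  isCommutativeRingˡ : ∀ {_+_ _*_ : Op₂ A} { -_ : Op₁ A} {0# 1# : A} → IsAbelianGroup _+_ 0# -_ →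
    Congruent₂ _*_ → Associative _*_ → Commutative _*_ → LeftIdentity 1# _*_ → _*_ DistributesOverʳ _+_ →
    IsCommutativeRing _+_ _*_ -_ 0# 1#
  isCommutativeRingˡ +-isAbelianGroup *-cong *-assoc *-comm *-identityˡ distribʳ = record
    { isRing = record
      { +-isAbelianGroup = +-isAbelianGroup
      ; *-cong           = *-cong
      ; *-assoc          = *-assoc
      ; *-identity       = comm∧idˡ⇒id *-comm *-identityˡ
      ; distrib          = comm∧distrʳ⇒distr (IsAbelianGroup.∙-cong +-isAbelianGroup) *-comm distribʳ
      }
    ; *-comm = *-comm
    }

coeff : Poly → ℕ → ℚ
coeff []      _       = 0ℚ
coeff (a ∷ p) zero    = a
coeff (a ∷ p) (suc i) = coeff p i

-- Coefficientwise equality of coefficient lists, i.e. equality up to trailing zeros.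
infix 4 _≋_
record _≋_ (p q : Poly) : Set where
  constructor mk≋
  field coeff-≡ : ∀ i → coeff p i ≡ coeff q i
open _≋_

≋-isEquivalence : IsEquivalence _≋_
≋-isEquivalence = record
  { refl  = mk≋ λ _ → ≡.refl
  ; sym   = λ p≋q → mk≋ λ i → ≡.sym (coeff-≡ p≋q i)
  ; trans = λ p≋q q≋r → mk≋ λ i → ≡.trans (coeff-≡ p≋q i) (coeff-≡ q≋r i)
  }

≋-setoid : Setoid 0ℓ 0ℓ
≋-setoid = record { isEquivalence = ≋-isEquivalence }

open IsEquivalence ≋-isEquivalence using () renaming (refl to ≋-refl; sym to ≋-sym; trans to ≋-trans; reflexive to ≋-reflexive)

∷-cong : ∀ {a b p q} → a ≡ b → p ≋ q → a ∷ p ≋ b ∷ q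
∷-cong a≡b p≋q = mk≋ λ { zero → a≡b ; (suc i) → coeff-≡ p≋q i }

[0]≋[] : 0ℚ ∷ [] ≋ []
[0]≋[] = mk≋ λ { zero → ≡.refl ; (suc i) → ≡.refl }

coeff-+ₚ : ∀ p q i → coeff (p +ₚ q) i ≡ coeff p i ℚ.+ coeff q i
coeff-+ₚ []      q       i       = ≡.sym (ℚ.+-identityˡ _)
coeff-+ₚ (a ∷ p) []      i       = ≡.sym (ℚ.+-identityʳ _)
coeff-+ₚ (a ∷ p) (b ∷ q) zero    = ≡.refl
coeff-+ₚ (a ∷ p) (b ∷ q) (suc i) = coeff-+ₚ p q i

coeff-scaleₚ : ∀ c p i → coeff (scaleₚ c p) i ≡ c ℚ.* coeff p i
coeff-scaleₚ c []      i       = ≡.sym (ℚ.*-zeroʳ c)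
coeff-scaleₚ c (a ∷ p) zero    = ≡.refl
coeff-scaleₚ c (a ∷ p) (suc i) = coeff-scaleₚ c p i

+ₚ-cong : ∀ {p p′ q q′} → p ≋ p′ → q ≋ q′ → p +ₚ q ≋ p′ +ₚ q′
+ₚ-cong {p} {p′} {q} {q′} p≋p′ q≋q′ = mk≋ λ i →
  ≡.trans (coeff-+ₚ p q i)
          (≡.trans (≡.cong₂ ℚ._+_ (coeff-≡ p≋p′ i) (coeff-≡ q≋q′ i)) (≡.sym (coeff-+ₚ p′ q′ i)))

scaleₚ-cong : ∀ c {p q} → p ≋ q → scaleₚ c p ≋ scaleₚ c q
scaleₚ-cong c {p} {q} p≋q = mk≋ λ i →
  ≡.trans (coeff-scaleₚ c p i) (≡.trans (≡.cong (c ℚ.*_) (coeff-≡ p≋q i)) (≡.sym (coeff-scaleₚ c q i)))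

scaleₚ-zero : ∀ p → scaleₚ 0ℚ p ≋ []
scaleₚ-zero p = mk≋ λ i → ≡.trans (coeff-scaleₚ 0ℚ p i) (ℚ.*-zeroˡ (coeff p i))

+ₚ-identityʳ : ∀ p → p +ₚ [] ≡ p
+ₚ-identityʳ []      = ≡.refl
+ₚ-identityʳ (a ∷ p) = ≡.refl

+ₚ-comm : ∀ p q → p +ₚ q ≡ q +ₚ p
+ₚ-comm []      q       = ≡.sym (+ₚ-identityʳ q)
+ₚ-comm (a ∷ p) []      = ≡.refl
+ₚ-comm (a ∷ p) (b ∷ q) = ≡.cong₂ _∷_ (ℚ.+-comm a b) (+ₚ-comm p q)

+ₚ-assoc : ∀ p q r → (p +ₚ q) +ₚ r ≡ p +ₚ (q +ₚ r)
+ₚ-assoc []      q       r       = ≡.refl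
+ₚ-assoc (a ∷ p) []      r       = ≡.refl
+ₚ-assoc (a ∷ p) (b ∷ q) []      = ≡.refl
+ₚ-assoc (a ∷ p) (b ∷ q) (c ∷ r) = ≡.cong₂ _∷_ (ℚ.+-assoc a b c) (+ₚ-assoc p q r)

-ₚ‿inverseˡ : ∀ p → (-ₚ p) +ₚ p ≋ []
-ₚ‿inverseˡ p = mk≋ λ i → ≡.trans (coeff-+ₚ (-ₚ p) p i)
  (≡.trans (≡.cong (ℚ._+ coeff p i) (coeff-scaleₚ (ℚ.- 1ℚ) p i)) (neg-one-cancel (coeff p i)))
  where
  neg-one-cancel : ∀ a → ℚ.- 1ℚ ℚ.* a ℚ.+ a ≡ 0ℚ
  neg-one-cancel a = ≡.trans (≡.cong (ℚ._+ a) (-1*x≈-x a)) (ℚ.+-inverseˡ a)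

+ₚ-isAbelianGroup : Structures.IsAbelianGroup _≋_ _+ₚ_ [] -ₚ_
+ₚ-isAbelianGroup = LeftLaws.isAbelianGroupˡ ≋-isEquivalence +ₚ-cong (scaleₚ-cong (ℚ.- 1ℚ))
  (λ p q r → ≋-reflexive (+ₚ-assoc p q r)) (λ p q → ≋-reflexive (+ₚ-comm p q)) (λ _ → ≋-refl) -ₚ‿inverseˡ

+ₚ-abelianGroup : AbelianGroup 0ℓ 0ℓ
+ₚ-abelianGroup = record { isAbelianGroup = +ₚ-isAbelianGroup }

open import Algebra.Properties.CommutativeSemigroup (AbelianGroup.commutativeSemigroup +ₚ-abelianGroup)
  using () renaming (interchange to +ₚ-interchange; x∙yz≈y∙xz to +ₚ-left-comm)

+ₚ-congˡ : ∀ p {q q′} → q ≋ q′ → p +ₚ q ≋ p +ₚ q′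
+ₚ-congˡ p = +ₚ-cong ≋-refl

0∷-+ₚ : ∀ p q → (0ℚ ∷ p) +ₚ (0ℚ ∷ q) ≋ 0ℚ ∷ (p +ₚ q)
0∷-+ₚ p q = ∷-cong (ℚ.+-identityˡ 0ℚ) ≋-refl

scaleₚ-0∷ : ∀ c p → scaleₚ c (0ℚ ∷ p) ≋ 0ℚ ∷ scaleₚ c p
scaleₚ-0∷ c p = ∷-cong (ℚ.*-zeroʳ c) ≋-refl

scaleₚ-+ₚ : ∀ c p q → scaleₚ c (p +ₚ q) ≡ scaleₚ c p +ₚ scaleₚ c q
scaleₚ-+ₚ c []      q       = ≡.refl
scaleₚ-+ₚ c (a ∷ p) []      = ≡.refl
scaleₚ-+ₚ c (a ∷ p) (b ∷ q) = ≡.cong₂ _∷_ (ℚ.*-distribˡ-+ c a b) (scaleₚ-+ₚ c p q)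

scaleₚ-distribʳ : ∀ a b p → scaleₚ (a ℚ.+ b) p ≡ scaleₚ a p +ₚ scaleₚ b p
scaleₚ-distribʳ a b []      = ≡.refl
scaleₚ-distribʳ a b (c ∷ p) = ≡.cong₂ _∷_ (ℚ.*-distribʳ-+ c a b) (scaleₚ-distribʳ a b p)

scaleₚ-assoc : ∀ a b p → scaleₚ (a ℚ.* b) p ≡ scaleₚ a (scaleₚ b p)
scaleₚ-assoc a b []      = ≡.refl
scaleₚ-assoc a b (c ∷ p) = ≡.cong₂ _∷_ (ℚ.*-assoc a b c) (scaleₚ-assoc a b p)

scaleₚ-identity : ∀ p → scaleₚ 1ℚ p ≡ p
scaleₚ-identity []      = ≡.refl
scaleₚ-identity (a ∷ p) = ≡.cong₂ _∷_ (ℚ.*-identityˡ a) (scaleₚ-identity p)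

*ₚ-zeroʳ : ∀ p → p *ₚ [] ≋ []
*ₚ-zeroʳ []      = ≋-refl
*ₚ-zeroʳ (a ∷ p) = ≋-trans (∷-cong ≡.refl (*ₚ-zeroʳ p)) [0]≋[]

0∷-*ₚ : ∀ p q → (0ℚ ∷ p) *ₚ q ≋ 0ℚ ∷ p *ₚ q
0∷-*ₚ p q = +ₚ-cong (scaleₚ-zero q) ≋-refl

scaleₚ-*ₚ : ∀ c p q → scaleₚ c p *ₚ q ≋ scaleₚ c (p *ₚ q)
scaleₚ-*ₚ c []      q = ≋-refl
scaleₚ-*ₚ c (a ∷ p) q = begin
  scaleₚ (c ℚ.* a) q +ₚ (0ℚ ∷ scaleₚ c p *ₚ q)
    ≈⟨ +ₚ-cong (≋-reflexive (scaleₚ-assoc c a q)) (∷-cong ≡.refl (scaleₚ-*ₚ c p q)) ⟩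
  scaleₚ c (scaleₚ a q) +ₚ (0ℚ ∷ scaleₚ c (p *ₚ q))
    ≈⟨ +ₚ-congˡ (scaleₚ c (scaleₚ a q)) (scaleₚ-0∷ c (p *ₚ q)) ⟨
  scaleₚ c (scaleₚ a q) +ₚ scaleₚ c (0ℚ ∷ p *ₚ q)
    ≡⟨ scaleₚ-+ₚ c (scaleₚ a q) (0ℚ ∷ p *ₚ q) ⟨
  scaleₚ c (scaleₚ a q +ₚ (0ℚ ∷ p *ₚ q)) ∎
  where open import Relation.Binary.Reasoning.Setoid ≋-setoid

*ₚ-distribʳ : ∀ p q r → (p +ₚ q) *ₚ r ≋ p *ₚ r +ₚ q *ₚ r
*ₚ-distribʳ []      q       r = ≋-refl
*ₚ-distribʳ (a ∷ p) []      r = ≋-reflexive (≡.sym (+ₚ-identityʳ _))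
*ₚ-distribʳ (a ∷ p) (b ∷ q) r = begin
  scaleₚ (a ℚ.+ b) r +ₚ (0ℚ ∷ (p +ₚ q) *ₚ r)
    ≈⟨ +ₚ-cong (≋-reflexive (scaleₚ-distribʳ a b r)) (∷-cong ≡.refl (*ₚ-distribʳ p q r)) ⟩
  (scaleₚ a r +ₚ scaleₚ b r) +ₚ (0ℚ ∷ p *ₚ r +ₚ q *ₚ r)
    ≈⟨ +ₚ-congˡ (scaleₚ a r +ₚ scaleₚ b r) (0∷-+ₚ (p *ₚ r) (q *ₚ r)) ⟨
  (scaleₚ a r +ₚ scaleₚ b r) +ₚ ((0ℚ ∷ p *ₚ r) +ₚ (0ℚ ∷ q *ₚ r))
    ≈⟨ +ₚ-interchange (scaleₚ a r) (scaleₚ b r) (0ℚ ∷ p *ₚ r) (0ℚ ∷ q *ₚ r) ⟩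
  (scaleₚ a r +ₚ (0ℚ ∷ p *ₚ r)) +ₚ (scaleₚ b r +ₚ (0ℚ ∷ q *ₚ r)) ∎
  where open import Relation.Binary.Reasoning.Setoid ≋-setoid

*ₚ-∷ʳ : ∀ p b q → p *ₚ (b ∷ q) ≋ scaleₚ b p +ₚ (0ℚ ∷ p *ₚ q)
*ₚ-∷ʳ []      b q = ≋-sym [0]≋[]
*ₚ-∷ʳ (a ∷ p) b q = ∷-cong (≡.cong (ℚ._+ 0ℚ) (ℚ.*-comm a b))
  (≋-trans (+ₚ-congˡ (scaleₚ a q) (*ₚ-∷ʳ p b q)) (+ₚ-left-comm (scaleₚ a q) (scaleₚ b p) (0ℚ ∷ p *ₚ q)))

*ₚ-comm : ∀ p q → p *ₚ q ≋ q *ₚ p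
*ₚ-comm []      q = ≋-sym (*ₚ-zeroʳ q)
*ₚ-comm (a ∷ p) q = ≋-trans (+ₚ-congˡ (scaleₚ a q) (∷-cong ≡.refl (*ₚ-comm p q))) (≋-sym (*ₚ-∷ʳ q a p))

≋[]⇒*ₚ≋[] : ∀ {p} q → p ≋ [] → p *ₚ q ≋ []
≋[]⇒*ₚ≋[] {[]}    q _       = ≋-refl
≋[]⇒*ₚ≋[] {a ∷ p} q a∷p≋[] = +ₚ-cong
  (≋-trans (≋-reflexive (≡.cong (λ c → scaleₚ c q) (coeff-≡ a∷p≋[] 0))) (scaleₚ-zero q))
  (≋-trans (∷-cong ≡.refl (≋[]⇒*ₚ≋[] {p} q (mk≋ (coeff-≡ a∷p≋[] ∘ suc)))) [0]≋[])

*ₚ-congʳ : ∀ {p p′} q → p ≋ p′ → p *ₚ q ≋ p′ *ₚ q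
*ₚ-congʳ {[]}    {p′}      q []≋p′ = ≋-sym (≋[]⇒*ₚ≋[] q (≋-sym []≋p′))
*ₚ-congʳ {a ∷ p} {[]}      q p≋[]  = ≋[]⇒*ₚ≋[] q p≋[]
*ₚ-congʳ {a ∷ p} {a′ ∷ p′} q p≋p′  = +ₚ-cong (≋-reflexive (≡.cong (λ c → scaleₚ c q) (coeff-≡ p≋p′ 0)))
  (∷-cong ≡.refl (*ₚ-congʳ {p} {p′} q (mk≋ (coeff-≡ p≋p′ ∘ suc))))

*ₚ-congˡ : ∀ p {q q′} → q ≋ q′ → p *ₚ q ≋ p *ₚ q′
*ₚ-congˡ p {q} {q′} q≋q′ = ≋-trans (*ₚ-comm p q) (≋-trans (*ₚ-congʳ p q≋q′) (*ₚ-comm q′ p))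

*ₚ-cong : ∀ {p p′ q q′} → p ≋ p′ → q ≋ q′ → p *ₚ q ≋ p′ *ₚ q′
*ₚ-cong {p} {p′} {q} {q′} p≋p′ q≋q′ =
  ≋-trans (*ₚ-congʳ q p≋p′) (*ₚ-congˡ p′ q≋q′)

*ₚ-assoc : ∀ p q r → (p *ₚ q) *ₚ r ≋ p *ₚ (q *ₚ r)
*ₚ-assoc []      q r = ≋-refl
*ₚ-assoc (a ∷ p) q r = begin
  (scaleₚ a q +ₚ (0ℚ ∷ p *ₚ q)) *ₚ r
    ≈⟨ *ₚ-distribʳ (scaleₚ a q) (0ℚ ∷ p *ₚ q) r ⟩
  scaleₚ a q *ₚ r +ₚ (0ℚ ∷ p *ₚ q) *ₚ r
    ≈⟨ +ₚ-cong (scaleₚ-*ₚ a q r) (≋-trans (0∷-*ₚ (p *ₚ q) r) (∷-cong ≡.refl (*ₚ-assoc p q r))) ⟩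
  scaleₚ a (q *ₚ r) +ₚ (0ℚ ∷ p *ₚ (q *ₚ r)) ∎
  where open import Relation.Binary.Reasoning.Setoid ≋-setoid

*ₚ-identityˡ : ∀ p → (1ℚ ∷ []) *ₚ p ≋ p
*ₚ-identityˡ p =
  ≋-trans (+ₚ-cong {scaleₚ 1ℚ p} {p} (≋-reflexive (scaleₚ-identity p)) [0]≋[]) (≋-reflexive (+ₚ-identityʳ p))

ℚ[t]-commutativeRing : CommutativeRing 0ℓ 0ℓ
ℚ[t]-commutativeRing = record
  { Carrier = Poly ; _≈_ = _≋_ ; _+_ = _+ₚ_ ; _*_ = _*ₚ_ ; -_ = -ₚ_ ; 0# = [] ; 1# = 1ℚ ∷ []
  ; isCommutativeRing = LeftLaws.isCommutativeRingˡ ≋-isEquivalence +ₚ-isAbelianGroup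
      *ₚ-cong *ₚ-assoc *ₚ-comm *ₚ-identityˡ (λ r p q → *ₚ-distribʳ p q r)
  }

[]≋? : ∀ p → Maybe ([] ≋ p)
[]≋? []      = just ≋-refl
[]≋? (a ∷ p) with 0ℚ ℚ.≟ a | []≋? p
... | yes 0≡a | just []≋p = just (mk≋ λ { zero → 0≡a ; (suc i) → coeff-≡ []≋p i })
... | _       | _         = nothing

ℚ[t]-almostCommutativeRing : Reflective.AlmostCommutativeRing 0ℓ 0ℓ
ℚ[t]-almostCommutativeRing = Reflective.fromCommutativeRing ℚ[t]-commutativeRing []≋?

-- The fragment ℚ⟨t⟩ of ℚ(t)

module ℚ[t] = CommutativeRing ℚ[t]-commutativeRing

*-cancel-nonZero : ∀ c .{{_ : ℚ.NonZero c}} a → c ℚ.* a ≡ 0ℚ → a ≡ 0ℚ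
*-cancel-nonZero c a c*a≡0 = begin
  a                    ≡⟨ ℚ.*-identityˡ a ⟨
  1ℚ ℚ.* a             ≡⟨ ≡.cong (ℚ._* a) (ℚ.*-inverseˡ c) ⟨
  ℚ.1/ c ℚ.* c ℚ.* a   ≡⟨ ℚ.*-assoc (ℚ.1/ c) c a ⟩
  ℚ.1/ c ℚ.* (c ℚ.* a) ≡⟨ ≡.cong (ℚ.1/ c ℚ.*_) c*a≡0 ⟩
  ℚ.1/ c ℚ.* 0ℚ        ≡⟨ ℚ.*-zeroʳ (ℚ.1/ c) ⟩
  0ℚ                   ∎
  where open ≡.≡-Reasoning

shiftP-*ₚ : ∀ c p → shiftP c *ₚ p ≋ scaleₚ (ℤ.+ c ℚ./ 1) p +ₚ (0ℚ ∷ p)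
shiftP-*ₚ c p = +ₚ-congˡ (scaleₚ (ℤ.+ c ℚ./ 1) p) (∷-cong ≡.refl (*ₚ-identityˡ p))

-- For c = 0 the product is the shift 0 ∷ p; otherwise its coefficients vanish from the bottom up
-- only if those of p do, as c ≠ 0.
shiftP-cancel : ∀ c p → shiftP c *ₚ p ≋ [] → p ≋ []
shiftP-cancel zero    p       t*p≋[] =
  mk≋ (coeff-≡ (≋-trans (≋-sym (≋-trans (shiftP-*ₚ 0 p) (+ₚ-cong (scaleₚ-zero p) ≋-refl))) t*p≋[]) ∘ suc)
shiftP-cancel (suc n) []      _      = ≋-refl
shiftP-cancel (suc n) (a ∷ p) e      = ≋-trans (∷-cong a≡0 (shiftP-cancel (suc n) p tail≋[])) [0]≋[]
  where
  c : ℚ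
  c = ℤ.+ suc n ℚ./ 1
  instance
    c-nonZero : ℚ.NonZero c
    c-nonZero = ℚ.pos⇒nonZero c {{ℚ.normalize-pos (suc n) 1}}
  expanded : (c ℚ.* a ℚ.+ 0ℚ) ∷ (scaleₚ c p +ₚ (a ∷ p)) ≋ []
  expanded = ≋-trans (≋-sym (shiftP-*ₚ (suc n) (a ∷ p))) e
  a≡0 : a ≡ 0ℚ
  a≡0 = *-cancel-nonZero c a (≡.trans (≡.sym (ℚ.+-identityʳ _)) (coeff-≡ expanded 0))
  tail≋[] : shiftP (suc n) *ₚ p ≋ []
  tail≋[] = ≋-trans (shiftP-*ₚ (suc n) p)
              (≋-trans (+ₚ-congˡ (scaleₚ c p) (∷-cong (≡.sym a≡0) ≋-refl)) (mk≋ (coeff-≡ expanded ∘ suc)))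

denPoly-cancel : ∀ ds p → denPoly ds *ₚ p ≋ [] → p ≋ []
denPoly-cancel []       p D*p≋[] = ≋-trans (≋-sym (*ₚ-identityˡ p)) D*p≋[]
denPoly-cancel (c ∷ ds) p D*p≋[] =
  denPoly-cancel ds p (shiftP-cancel c (denPoly ds *ₚ p) (≋-trans (≋-sym (*ₚ-assoc (shiftP c) (denPoly ds) p)) D*p≋[]))

*ₚ-cancelʳ-denPoly : ∀ ds p q → p *ₚ denPoly ds ≋ q *ₚ denPoly ds → p ≋ q
*ₚ-cancelʳ-denPoly ds p q pD≋qD = x∙y⁻¹≈ε⇒x≈y p q (denPoly-cancel ds (p +ₚ -ₚ q) (begin
  denPoly ds *ₚ (p +ₚ -ₚ q)         ≈⟨ *ₚ-comm (denPoly ds) _ ⟩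
  (p +ₚ -ₚ q) *ₚ denPoly ds         ≈⟨ [y-z]x≈yx-zx (denPoly ds) p q ⟩
  p *ₚ denPoly ds +ₚ -ₚ (q *ₚ denPoly ds) ≈⟨ ℚ[t].+-congʳ pD≋qD ⟩
  q *ₚ denPoly ds +ₚ -ₚ (q *ₚ denPoly ds) ≈⟨ ℚ[t].-‿inverseʳ (q *ₚ denPoly ds) ⟩
  []                                ∎))
  where
  open import Relation.Binary.Reasoning.Setoid ≋-setoid
  open import Algebra.Properties.Ring ℚ[t].ring using (x∙y⁻¹≈ε⇒x≈y; [y-z]x≈yx-zx)

denPoly-++ : ∀ ds es → denPoly (ds ++ es) ≋ denPoly ds *ₚ denPoly es
denPoly-++ []       es = ≋-sym (*ₚ-identityˡ (denPoly es))
denPoly-++ (c ∷ ds) es =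
  ≋-trans (*ₚ-congˡ (shiftP c) (denPoly-++ ds es)) (≋-sym (*ₚ-assoc (shiftP c) (denPoly ds) (denPoly es)))

-- The equality _≈ᵣ_ of Defs, with ≋ in place of its test on the coefficients of the difference.
infix 4 _≃_
record _≃_ (x y : ℚ⟨t⟩) : Set where
  constructor mk≃
  field cross : num x *ₚ denPoly (den y) ≋ num y *ₚ denPoly (den x)
open _≃_

-ᵣ_ : ℚ⟨t⟩ → ℚ⟨t⟩
-ᵣ x = (-ₚ num x) // den x

≃-refl : ∀ {x} → x ≃ x
≃-refl = mk≃ ≋-refl

≃-sym : ∀ {x y} → x ≃ y → y ≃ x
≃-sym x≃y = mk≃ (≋-sym (cross x≃y))

≃-trans : ∀ {x y z} → x ≃ y → y ≃ z → x ≃ z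
≃-trans {a // dx} {b // dy} {c // dz} x≃y y≃z = mk≃ (*ₚ-cancelʳ-denPoly dy (a *ₚ C) (c *ₚ A) (begin
  (a *ₚ C) *ₚ B ≈⟨ xy∙z≈xz∙y a C B ⟩
  (a *ₚ B) *ₚ C ≈⟨ ℚ[t].*-congʳ (cross x≃y) ⟩
  (b *ₚ A) *ₚ C ≈⟨ xy∙z≈xz∙y b A C ⟩
  (b *ₚ C) *ₚ A ≈⟨ ℚ[t].*-congʳ (cross y≃z) ⟩
  (c *ₚ B) *ₚ A ≈⟨ xy∙z≈xz∙y c B A ⟩
  (c *ₚ A) *ₚ B ∎))
  where
  open import Relation.Binary.Reasoning.Setoid ≋-setoid
  open import Algebra.Properties.CommutativeSemigroup ℚ[t].*-commutativeSemigroup using (xy∙z≈xz∙y)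
  A B C : Poly
  A = denPoly dx
  B = denPoly dy
  C = denPoly dz

≃-by : ∀ {x y} X Y → denPoly (den x) ≋ X → denPoly (den y) ≋ Y → num x *ₚ Y ≋ num y *ₚ X → x ≃ y
≃-by {x} {y} X Y Dx≋X Dy≋Y xY≋yX =
  mk≃ (≋-trans (*ₚ-congˡ (num x) Dy≋Y) (≋-trans xY≋yX (*ₚ-congˡ (num y) (≋-sym Dx≋X))))

+ᵣ-cong : ∀ {x x′ y y′} → x ≃ x′ → y ≃ y′ → x +ᵣ y ≃ x′ +ᵣ y′
+ᵣ-cong {a // dx} {a′ // dx′} {b // dy} {b′ // dy′} x≃x′ y≃y′ =
  ≃-by (A *ₚ B) (A′ *ₚ B′) (denPoly-++ dx dy) (denPoly-++ dx′ dy′) (begin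
    (a *ₚ B +ₚ b *ₚ A) *ₚ (A′ *ₚ B′)                 ≈⟨ expand a b A B A′ B′ ⟩
    (a *ₚ A′) *ₚ (B *ₚ B′) +ₚ (b *ₚ B′) *ₚ (A *ₚ A′)
      ≈⟨ +ₚ-cong (*ₚ-congʳ (B *ₚ B′) (cross x≃x′)) (*ₚ-congʳ (A *ₚ A′) (cross y≃y′)) ⟩
    (a′ *ₚ A) *ₚ (B *ₚ B′) +ₚ (b′ *ₚ B) *ₚ (A *ₚ A′) ≈⟨ collect a′ b′ A B A′ B′ ⟩
    (a′ *ₚ B′ +ₚ b′ *ₚ A′) *ₚ (A *ₚ B)               ∎)
  where
  open import Relation.Binary.Reasoning.Setoid ≋-setoid
  A B A′ B′ : Poly
  A = denPoly dx
  B = denPoly dy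
  A′ = denPoly dx′
  B′ = denPoly dy′
  expand : ∀ a b A B A′ B′ →
    (a *ₚ B +ₚ b *ₚ A) *ₚ (A′ *ₚ B′) ≋ (a *ₚ A′) *ₚ (B *ₚ B′) +ₚ (b *ₚ B′) *ₚ (A *ₚ A′)
  expand = solve-∀ ℚ[t]-almostCommutativeRing
  collect : ∀ a′ b′ A B A′ B′ →
    (a′ *ₚ A) *ₚ (B *ₚ B′) +ₚ (b′ *ₚ B) *ₚ (A *ₚ A′) ≋ (a′ *ₚ B′ +ₚ b′ *ₚ A′) *ₚ (A *ₚ B)
  collect = solve-∀ ℚ[t]-almostCommutativeRing

*ᵣ-cong : ∀ {x x′ y y′} → x ≃ x′ → y ≃ y′ → x *ᵣ y ≃ x′ *ᵣ y′
*ᵣ-cong {a // dx} {a′ // dx′} {b // dy} {b′ // dy′} x≃x′ y≃y′ =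
  ≃-by (A *ₚ B) (A′ *ₚ B′) (denPoly-++ dx dy) (denPoly-++ dx′ dy′) (begin
    (a *ₚ b) *ₚ (A′ *ₚ B′)   ≈⟨ interchange a b A′ B′ ⟩
    (a *ₚ A′) *ₚ (b *ₚ B′)   ≈⟨ *ₚ-cong (cross x≃x′) (cross y≃y′) ⟩
    (a′ *ₚ A) *ₚ (b′ *ₚ B)   ≈⟨ interchange a′ A b′ B ⟩
    (a′ *ₚ b′) *ₚ (A *ₚ B)   ∎)
  where
  open import Relation.Binary.Reasoning.Setoid ≋-setoid
  open import Algebra.Properties.CommutativeSemigroup ℚ[t].*-commutativeSemigroup using (interchange)
  A B A′ B′ : Poly
  A = denPoly dx
  B = denPoly dy
  A′ = denPoly dx′
  B′ = denPoly dy′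

-ᵣ-cong : ∀ {x y} → x ≃ y → -ᵣ x ≃ -ᵣ y
-ᵣ-cong {a // dx} {b // dy} x≃y = mk≃ (≋-trans (≋-sym (-‿distribˡ-* a (denPoly dy)))
  (≋-trans (ℚ[t].-‿cong (cross x≃y)) (-‿distribˡ-* b (denPoly dx))))
  where open import Algebra.Properties.Ring ℚ[t].ring using (-‿distribˡ-*)

denPoly-++-assoc : ∀ ds es fs → denPoly ((ds ++ es) ++ fs) ≋ denPoly ds *ₚ denPoly es *ₚ denPoly fs
denPoly-++-assoc ds es fs = ≋-trans (denPoly-++ (ds ++ es) fs) (*ₚ-congʳ (denPoly fs) (denPoly-++ ds es))

+ᵣ-assoc : ∀ x y z → (x +ᵣ y) +ᵣ z ≃ x +ᵣ (y +ᵣ z)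
+ᵣ-assoc (a // dx) (b // dy) (c // dz) = ≃-by (A *ₚ B *ₚ C) (A *ₚ B *ₚ C) (denPoly-++-assoc dx dy dz)
  (≋-trans (≋-reflexive (≡.cong denPoly (≡.sym (List.++-assoc dx dy dz)))) (denPoly-++-assoc dx dy dz)) (begin
    ((a *ₚ B +ₚ b *ₚ A) *ₚ C +ₚ c *ₚ denPoly (dx ++ dy)) *ₚ (A *ₚ B *ₚ C)
      ≈⟨ *ₚ-congʳ (A *ₚ B *ₚ C) (+ₚ-congˡ ((a *ₚ B +ₚ b *ₚ A) *ₚ C) (*ₚ-congˡ c (denPoly-++ dx dy))) ⟩
    ((a *ₚ B +ₚ b *ₚ A) *ₚ C +ₚ c *ₚ (A *ₚ B)) *ₚ (A *ₚ B *ₚ C)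
      ≈⟨ regroup a b c A B C ⟩
    (a *ₚ (B *ₚ C) +ₚ (b *ₚ C +ₚ c *ₚ B) *ₚ A) *ₚ (A *ₚ B *ₚ C)
      ≈⟨ *ₚ-congʳ (A *ₚ B *ₚ C) (+ₚ-cong (*ₚ-congˡ a (denPoly-++ dy dz)) ≋-refl) ⟨
    (a *ₚ denPoly (dy ++ dz) +ₚ (b *ₚ C +ₚ c *ₚ B) *ₚ A) *ₚ (A *ₚ B *ₚ C) ∎)
  where
  open import Relation.Binary.Reasoning.Setoid ≋-setoid
  A B C : Poly
  A = denPoly dx
  B = denPoly dy
  C = denPoly dz
  regroup : ∀ a b c A B C → ((a *ₚ B +ₚ b *ₚ A) *ₚ C +ₚ c *ₚ (A *ₚ B)) *ₚ (A *ₚ B *ₚ C) ≋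
                            (a *ₚ (B *ₚ C) +ₚ (b *ₚ C +ₚ c *ₚ B) *ₚ A) *ₚ (A *ₚ B *ₚ C)
  regroup = solve-∀ ℚ[t]-almostCommutativeRing

+ᵣ-comm : ∀ x y → x +ᵣ y ≃ y +ᵣ x
+ᵣ-comm (a // dx) (b // dy) = ≃-by (A *ₚ B) (B *ₚ A) (denPoly-++ dx dy) (denPoly-++ dy dx)
  (*ₚ-cong (≋-reflexive (+ₚ-comm (a *ₚ B) (b *ₚ A))) (*ₚ-comm B A))
  where
  A B : Poly
  A = denPoly dx
  B = denPoly dy

*ᵣ-comm : ∀ x y → x *ᵣ y ≃ y *ᵣ x
*ᵣ-comm (a // dx) (b // dy) =
  ≃-by (A *ₚ B) (B *ₚ A) (denPoly-++ dx dy) (denPoly-++ dy dx) (*ₚ-cong (*ₚ-comm a b) (*ₚ-comm B A))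
  where
  A B : Poly
  A = denPoly dx
  B = denPoly dy

*ᵣ-assoc : ∀ x y z → (x *ᵣ y) *ᵣ z ≃ x *ᵣ (y *ᵣ z)
*ᵣ-assoc (a // dx) (b // dy) (c // dz) = mk≃ (*ₚ-cong (*ₚ-assoc a b c)
  (≋-reflexive (≡.cong denPoly (≡.sym (List.++-assoc dx dy dz)))))

+ᵣ-identityˡ : ∀ x → 0ᵣ +ᵣ x ≃ x
+ᵣ-identityˡ (a // dx) = mk≃ (simplify a (denPoly dx))
  where
  simplify : ∀ a A → ((0ℚ ∷ []) *ₚ A +ₚ a *ₚ (1ℚ ∷ [])) *ₚ A ≋ a *ₚ A
  simplify = solve-∀ ℚ[t]-almostCommutativeRing

*ᵣ-identityˡ : ∀ x → 1ᵣ *ᵣ x ≃ x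
*ᵣ-identityˡ (a // dx) = mk≃ (*ₚ-congʳ (denPoly dx) (*ₚ-identityˡ a))

-ᵣ‿inverseˡ : ∀ x → (-ᵣ x) +ᵣ x ≃ 0ᵣ
-ᵣ‿inverseˡ (a // dx) = mk≃ (cancel a (denPoly dx) (denPoly (dx ++ dx)))
  where
  cancel : ∀ a A B → ((-ₚ a) *ₚ A +ₚ a *ₚ A) *ₚ (1ℚ ∷ []) ≋ (0ℚ ∷ []) *ₚ B
  cancel = solve-∀ ℚ[t]-almostCommutativeRing

*ᵣ-distribʳ : ∀ x y z → (y +ᵣ z) *ᵣ x ≃ y *ᵣ x +ᵣ z *ᵣ x
*ᵣ-distribʳ (a // dx) (b // dy) (c // dz) =
  ≃-by (B *ₚ C *ₚ A) ((B *ₚ A) *ₚ (C *ₚ A))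
    (≋-trans (denPoly-++ (dy ++ dz) dx) (*ₚ-congʳ A (denPoly-++ dy dz)))
    (≋-trans (denPoly-++ (dy ++ dx) (dz ++ dx)) (*ₚ-cong (denPoly-++ dy dx) (denPoly-++ dz dx))) (begin
      ((b *ₚ C +ₚ c *ₚ B) *ₚ a) *ₚ ((B *ₚ A) *ₚ (C *ₚ A))
        ≈⟨ regroup a b c A B C ⟩
      ((b *ₚ a) *ₚ (C *ₚ A) +ₚ (c *ₚ a) *ₚ (B *ₚ A)) *ₚ (B *ₚ C *ₚ A)
        ≈⟨ *ₚ-congʳ (B *ₚ C *ₚ A)
             (+ₚ-cong (*ₚ-congˡ (b *ₚ a) (denPoly-++ dz dx)) (*ₚ-congˡ (c *ₚ a) (denPoly-++ dy dx))) ⟨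
      ((b *ₚ a) *ₚ denPoly (dz ++ dx) +ₚ (c *ₚ a) *ₚ denPoly (dy ++ dx)) *ₚ (B *ₚ C *ₚ A) ∎)
  where
  open import Relation.Binary.Reasoning.Setoid ≋-setoid
  A B C : Poly
  A = denPoly dx
  B = denPoly dy
  C = denPoly dz
  regroup : ∀ a b c A B C → ((b *ₚ C +ₚ c *ₚ B) *ₚ a) *ₚ ((B *ₚ A) *ₚ (C *ₚ A)) ≋
                            ((b *ₚ a) *ₚ (C *ₚ A) +ₚ (c *ₚ a) *ₚ (B *ₚ A)) *ₚ (B *ₚ C *ₚ A)
  regroup = solve-∀ ℚ[t]-almostCommutativeRing

≃-isEquivalence : IsEquivalence _≃_
≃-isEquivalence = record { refl = ≃-refl ; sym = ≃-sym ; trans = ≃-trans }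

ℚ⟨t⟩-commutativeRing : CommutativeRing 0ℓ 0ℓ
ℚ⟨t⟩-commutativeRing = record
  { Carrier = ℚ⟨t⟩ ; _≈_ = _≃_ ; _+_ = _+ᵣ_ ; _*_ = _*ᵣ_ ; -_ = -ᵣ_ ; 0# = 0ᵣ ; 1# = 1ᵣ
  ; isCommutativeRing = LeftLaws.isCommutativeRingˡ ≃-isEquivalence
      (LeftLaws.isAbelianGroupˡ ≃-isEquivalence +ᵣ-cong -ᵣ-cong +ᵣ-assoc +ᵣ-comm +ᵣ-identityˡ -ᵣ‿inverseˡ)
      *ᵣ-cong *ᵣ-assoc *ᵣ-comm *ᵣ-identityˡ (λ x y z → *ᵣ-distribʳ x y z)
  }

*ₚ-identityʳ : ∀ p → p *ₚ (1ℚ ∷ []) ≋ p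
*ₚ-identityʳ p = ≋-trans (*ₚ-comm p (1ℚ ∷ [])) (*ₚ-identityˡ p)

constᵣ-isRingHomomorphism : IsRingHomomorphism ℚ.+-*-rawRing (CommutativeRing.rawRing ℚ⟨t⟩-commutativeRing) constᵣ
constᵣ-isRingHomomorphism = record
  { isSemiringHomomorphism = record
    { isNearSemiringHomomorphism = record
      { +-isMonoidHomomorphism = record
        { isMagmaHomomorphism = record
          { isRelHomomorphism = record { cong = λ { ≡.refl → ≃-refl } }
          ; homo              = λ a b → mk≃ (≋-trans (*ₚ-identityʳ ((a ℚ.+ b) ∷ []))
                                  (≋-sym (≋-trans (*ₚ-identityʳ ((a ∷ []) *ₚ (1ℚ ∷ []) +ₚ (b ∷ []) *ₚ (1ℚ ∷ [])))
                                    (+ₚ-cong (*ₚ-identityʳ (a ∷ [])) (*ₚ-identityʳ (b ∷ []))))))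
          }
        ; ε-homo = ≃-refl
        }
      ; *-homo = λ a b → mk≃ (*ₚ-congʳ (1ℚ ∷ []) (≋-sym (∷-cong {p = []} {q = []} (ℚ.+-identityʳ (a ℚ.* b)) ≋-refl)))
      }
    ; 1#-homo = ≃-refl
    }
  ; -‿homo = λ a → mk≃ (*ₚ-congʳ (1ℚ ∷ []) (∷-cong {p = []} {q = []} (≡.sym (-1*x≈-x a)) ≋-refl))
  }

≃⇒≈ᵣ : ∀ {x y} → x ≃ y → x ≈ᵣ y
≃⇒≈ᵣ {x} {y} x≃y = zeros (≋-trans (+ₚ-cong {q = -ₚ yX} (cross x≃y) ≋-refl) (ℚ[t].-‿inverseʳ yX))
  where
  yX : Poly
  yX = num y *ₚ denPoly (den x)
  zeros : ∀ {p} → p ≋ [] → All (_≡ 0ℚ) p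
  zeros {[]}    _     = []
  zeros {a ∷ p} p≋[] = coeff-≡ p≋[] 0 ∷ zeros {p} (mk≋ (coeff-≡ p≋[] ∘ suc))

-- Instantiation at ℚ⟨t⟩

powℚ-+ : ∀ q a b → powℚ q (a ℕ.+ b) ≡ powℚ q a ℚ.* powℚ q b
powℚ-+ q zero    b = ≡.sym (ℚ.*-identityˡ _)
powℚ-+ q (suc a) b = ≡.trans (≡.cong (q ℚ.*_) (powℚ-+ q a b)) (≡.sym (ℚ.*-assoc q _ _))

invPow-+ : ∀ m a b → invPow m (a ℕ.+ b) ≡ invPow m a ℚ.* invPow m b
invPow-+ zero    a b = ≡.sym (ℚ.*-zeroˡ 0ℚ)
invPow-+ (suc m) a b = powℚ-+ _ a b

replicate-+ : ∀ {A : Set} a b (x : A) → replicate (a ℕ.+ b) x ≡ replicate a x ++ replicate b x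
replicate-+ zero    b x = ≡.refl
replicate-+ (suc a) b x = ≡.cong (x ∷_) (replicate-+ a b x)

invShiftPow-+ : ∀ c a b → invShiftPow c (a ℕ.+ b) ≃ invShiftPow c a *ᵣ invShiftPow c b
invShiftPow-+ c a b = mk≃ (≋-trans (*ₚ-congˡ (1ℚ ∷ []) (≋-reflexive (≡.cong denPoly (≡.sym (replicate-+ a b c)))))
  (*ₚ-congʳ (denPoly (replicate (a ℕ.+ b) c)) (≋-sym (*ₚ-identityˡ (1ℚ ∷ [])))))

module ℚ⟨t⟩-ring = CommutativeRing ℚ⟨t⟩-commutativeRing
open IsRingHomomorphism constᵣ-isRingHomomorphism using (*-homo)
open LinearExtension ℚ⟨t⟩-commutativeRing constᵣ-isRingHomomorphism using (lin; lin-cong; lin-⊛̄)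

module _ (N : ℕ) where

  open ChainSums ℚ⟨t⟩-commutativeRing constᵣ-isRingHomomorphism
    (λ m k → constᵣ (invPow m k)) (λ m k → invShiftPow (N ∸ m) k)
    (λ m a b → ≃-trans (ℚ⟨t⟩-ring.reflexive (≡.cong constᵣ (invPow-+ m a b))) (*-homo (invPow m a) (invPow m b)))
    (λ m → invShiftPow-+ (N ∸ m))

  signᵣ≡sign : ∀ A → signᵣ A ≡ sign N A
  signᵣ≡sign []          = ≡.refl
  signᵣ≡sign (true  ∷ A) = ≡.cong (constᵣ (ℚ.- 1ℚ) *ᵣ_) (signᵣ≡sign A)
  signᵣ≡sign (false ∷ A) = signᵣ≡sign A

  termᵣ≡weight : ∀ ks A ns → termᵣ N ks A ns ≡ weight N ks A ns
  termᵣ≡weight []       A           ns       = ≡.refl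
  termᵣ≡weight (k ∷ ks) []          ns       = ≡.refl
  termᵣ≡weight (k ∷ ks) (true  ∷ A) []       = ≡.refl
  termᵣ≡weight (k ∷ ks) (false ∷ A) []       = ≡.refl
  termᵣ≡weight (k ∷ ks) (true  ∷ A) (n ∷ ns) = ≡.cong (invShiftPow (N ∸ n) k *ᵣ_) (termᵣ≡weight ks A ns)
  termᵣ≡weight (k ∷ ks) (false ∷ A) (n ∷ ns) = ≡.cong (constᵣ (invPow n k) *ᵣ_) (termᵣ≡weight ks A ns)

  F≡Fsum : ∀ ks → F N ks ≡ Fsum N ks
  F≡Fsum ks = ≡.cong sumᵣ (List.map-cong (λ A → ≡.cong₂ _*ᵣ_ (signᵣ≡sign A)
    (≡.cong sumᵣ (List.map-cong (termᵣ≡weight ks A) (filterB (inS A) (tuples N (length ks)))))) (subsets (length ks)))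

  Fword≈G : ∀ u → Fword N u ≃ G (N ∸ 1) (reverse u)
  Fword≈G []       = ≃-refl
  Fword≈G (k ∷ ks) = ≃-trans (ℚ⟨t⟩-ring.reflexive (F≡Fsum (k ∷ ks))) (Fsum≈G N (k ∷ ks))

  Fword-starWord : ∀ u v → lin (Fword N) (starWord u v) ≃ Fword N u *ᵣ Fword N v
  Fword-starWord u v = ≃-trans (lin-cong (starWord u v) Fword≈G)
    (≃-trans (G-starWord (N ∸ 1) u v) (*ᵣ-cong (≃-sym (Fword≈G u)) (≃-sym (Fword≈G v))))

-- 𝖥 N is lin (Fword N) by definition. Neither 1 ≤ N nor the positivity of the indices is needed.
proposition5p2 : (N : ℕ) → 1 ≤ N → (w₁ w₂ : H¹) → PositiveH¹ w₁ → PositiveH¹ w₂ →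
    𝖥 N w₁ *ᵣ 𝖥 N w₂ ≈ᵣ 𝖥 N (w₁ ⊛̄ w₂)
proposition5p2 N _ w₁ w₂ _ _ = ≃⇒≈ᵣ (≃-sym (lin-⊛̄ (Fword N) (Fword-starWord N) w₁ w₂))
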